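{- Let $k\ge3$. Any directed Hajós join of two digraphs in $E\vec{\mathcal{H}}\mathcal{T}_k$ belongs to $E\vec{\mathcal{H}}\mathcal{T}_k$.
   Context: Digraphs are finite, without loops or parallel arcs, but may contain digons; $[x,y]=\{xy,yx\}$. $\overleftrightarrow{G}$ is the symmetric digraph of an undirected graph $G$ (each edge replaced by a digon); $W_{2\ell+1}$ is a cycle of length $2\ell+1$ plus a vertex adjacent to all of its vertices. Directed Hajós join: for digraphs $D_1,D_2$ with $uv_1\in A(D_1)$, $v_2w\in A(D_2)$, take the disjoint union of $D_1-uv_1$ and $D_2-v_2w$, identify $v_1,v_2$ into a new vertex, and add the arc $uw$. Extended Hajós tree join: an Euler tour is a closed trail using every arc exactly once. For a tree $T$, an Eulerian list is the circular list of vertices encountered along an Euler tour of $\overleftrightarrow{T}$; a partial Eulerian list of $T$ is a circular sublist of an Eulerian list of $T$ containing every leaf of $T$ and each non-leaf vertex of $T$ at most once. Given a tree $T$ with edges $u_1v_1,\dots,u_nv_n$, a partial Eulerian list $(x_1,\dots,x_\ell)$ of $T$, and digraphs $D_i$ with $V(D_i)\cap V(T)=\{u_i,v_i\}$, $[u_i,v_i]\subseteq A(D_i)$, and the sets $V(D_i)\setminus\{u_i,v_i\}$ pairwise disjoint, the extended Hajós tree join is the union of the digraphs $D_i-[u_i,v_i]$ plus the directed cycle $x_1\to\dots\to x_\ell\to x_1$. $E\vec{\mathcal{H}}\mathcal{T}_3$ is the smallest class of digraphs containing all $\overleftrightarrow{W}_{2\ell+1}$ ($\ell\ge1$) and closed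 under extended Hajós tree joins; for $k\ge4$, $E\vec{\mathcal{H}}\mathcal{T}_k$ is the smallest class containing $\overleftrightarrow{K}_{k+1}$ and closed under extended Hajós tree joins. -}

module Defs where

open import Data.Bool using (if_then_else_)
open import Data.Nat using (ℕ; zero; suc; _+_; _*_; _≤_; _%_)
open import Data.Nat.Properties using (_≟_)
open import Data.Fin using (Fin; toℕ)
open import Data.Product using (Σ; ∃; ∃-syntax; _×_; _,_; proj₁; proj₂; swap)
open import Data.Sum using (_⊎_)
open import Data.Empty using (⊥)
open import Data.List using (List; []; _∷_; _++_; length; filter; concatMap; lookup)
open import Data.List.Membership.Propositional using (_∈_)
open import Data.List.Relation.Unary.All using (All)
open import Data.List.Relation.Unary.Unique.Propositional using (Unique)
open import Data.List.Relation.Binary.Permutation.Propositional using (_↭_)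
open import Data.List.Relation.Binary.Sublist.Propositional using (_⊆_)
open import Relation.Binary.PropositionalEquality using (_≡_; _≢_)
open import Relation.Nullary using (¬_; does)
open import Relation.Nullary.Decidable using (_⊎-dec_)

_⇔′_ : Set → Set → Set
P ⇔′ Q = (P → Q) × (Q → P)
infix 3 _⇔′_

Arc : Set
Arc = ℕ × ℕ

-- Digraphs: finite vertex set ⊆ ℕ, arc set, no loops, no parallel arcs
-- (digons allowed).

record Digraph : Set where
  field
    V : List ℕ
    A : List Arc
    V-unique : Unique V
    A-unique : Unique A
    A-in-V   : ∀ {x y} → (x , y) ∈ A → x ∈ V × y ∈ V
    loopless : ∀ {x} → ¬ ((x , x) ∈ A)
open Digraph public

InDigon : ℕ → ℕ → Arc → Set
InDigon x y a = a ≡ (x , y) ⊎ a ≡ (y , x)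

-- Symmetric digraph of an undirected graph on Fin m (given by a symmetric
-- adjacency relation), up to isomorphism: D ≅ ↔G via an injective labelling f.

IsSymOf : (m : ℕ) → (Fin m → Fin m → Set) → Digraph → Set
IsSymOf m adj D =
  Σ (Fin m → ℕ) λ f →
    (∀ i j → f i ≡ f j → i ≡ j) ×
    (∀ x → x ∈ V D ⇔′ (∃[ i ] x ≡ f i)) ×
    (∀ i j → (f i , f j) ∈ A D ⇔′ adj i j)

-- W_{2ℓ+1}: rim vertices 0..2ℓ forming the cycle i ~ i+1 (mod 2ℓ+1),
-- hub vertex 2ℓ+1 adjacent to all rim vertices.
WheelAdj : (ℓ : ℕ) → Fin (suc (suc (2 * ℓ))) → Fin (suc (suc (2 * ℓ))) → Set
WheelAdj ℓ i j =
  i ≢ j ×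
  (toℕ i ≡ n ⊎ toℕ j ≡ n ⊎ toℕ j ≡ suc (toℕ i) % n ⊎ toℕ i ≡ suc (toℕ j) % n)
  where
  n : ℕ
  n = suc (2 * ℓ)

KAdj : ∀ {m} → Fin m → Fin m → Set
KAdj i j = i ≢ j

cyclicGo : ℕ → List ℕ → List Arc
cyclicGo f [] = []
cyclicGo f (x ∷ []) = (x , f) ∷ []
cyclicGo f (x ∷ y ∷ r) = (x , y) ∷ cyclicGo f (y ∷ r)

cyclicArcs : List ℕ → List Arc
cyclicArcs [] = []
cyclicArcs (w ∷ ws) = cyclicGo w (w ∷ ws)

-- Undirected trees (edge list; each edge listed once in one orientation)

symArcs : List Arc → List Arc
symArcs E = concatMap (λ e → e ∷ swap e ∷ []) E

data Reach (E : List Arc) : ℕ → ℕ → Set where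
  here : ∀ {x} → Reach E x x
  step : ∀ {x y z} → (x , y) ∈ symArcs E → Reach E y z → Reach E x z

record Tree : Set where
  field
    TV : List ℕ
    TE : List Arc
    TV-unique   : Unique TV
    TE-in-V     : ∀ {x y} → (x , y) ∈ TE → x ∈ TV × y ∈ TV
    TE-loopless : ∀ {x} → ¬ ((x , x) ∈ TE)
    TE-simple   : Unique (symArcs TE)
    connected   : ∀ {x y} → x ∈ TV → y ∈ TV → Reach TE x y
    acyclic     : ∀ (c : List ℕ) → Unique c → 3 ≤ length c →
                  ¬ All (λ a → a ∈ symArcs TE) (cyclicArcs c)
open Tree public

deg : Tree → ℕ → ℕ
deg T v = length (filter {P = λ e → proj₁ e ≡ v ⊎ proj₂ e ≡ v}
                         (λ e → (proj₁ e ≟ v) ⊎-dec (proj₂ e ≟ v)) (TE T))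

Leaf : Tree → ℕ → Set
Leaf T v = v ∈ TV T × deg T v ≡ 1

occ : ℕ → List ℕ → ℕ
occ v xs = length (filter (λ y → y ≟ v) xs)

-- w is the circular list of vertices of an Euler tour of ↔T:
-- the closed walk w0 → w1 → ... → w_{m-1} → w0 uses every arc of ↔T exactly once.
EulerianList : Tree → List ℕ → Set
EulerianList T w = cyclicArcs w ↭ symArcs (TE T)

CircularSublist : List ℕ → List ℕ → Set
CircularSublist xs L = ∃[ P ] ∃[ Q ] (L ≡ P ++ Q × xs ⊆ Q ++ P)

PartialEulerianList : Tree → List ℕ → Set
PartialEulerianList T xs =
  (∃[ L ] (EulerianList T L × CircularSublist xs L)) ×
  (∀ v → Leaf T v → v ∈ xs) ×
  (∀ v → v ∈ TV T → ¬ Leaf T v → occ v xs ≤ 1)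

module _ (T : Tree) where
  edge : Fin (length (TE T)) → Arc
  edge i = lookup (TE T) i

  eu : Fin (length (TE T)) → ℕ
  eu i = proj₁ (edge i)

  ev : Fin (length (TE T)) → ℕ
  ev i = proj₂ (edge i)

IsTreeJoin : (T : Tree) → List ℕ → (Fin (length (TE T)) → Digraph) → Digraph → Set
IsTreeJoin T xs Ds D =
  1 ≤ length (TE T) ×
  PartialEulerianList T xs ×
  (∀ i x → (x ∈ V (Ds i) × x ∈ TV T) ⇔′ (x ≡ eu T i ⊎ x ≡ ev T i)) ×
  (∀ i → (eu T i , ev T i) ∈ A (Ds i) × (ev T i , eu T i) ∈ A (Ds i)) ×
  (∀ i j → i ≢ j → ∀ x → x ∈ V (Ds i) → x ∈ V (Ds j) →
     ¬ (x ≡ eu T i ⊎ x ≡ ev T i) → ¬ (x ≡ eu T j ⊎ x ≡ ev T j) → ⊥) ×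
  (∀ x → x ∈ V D ⇔′ ((∃[ i ] x ∈ V (Ds i)) ⊎ x ∈ xs)) ×
  (∀ a → a ∈ A D ⇔′
     ((∃[ i ] (a ∈ A (Ds i) × ¬ InDigon (eu T i) (ev T i) a)) ⊎ a ∈ cyclicArcs xs))

data EHT (k : ℕ) : Digraph → Set where
  wheel    : k ≡ 3 → ∀ ℓ → 1 ≤ ℓ → ∀ D →
             IsSymOf (suc (suc (2 * ℓ))) (WheelAdj ℓ) D → EHT k D
  complete : 4 ≤ k → ∀ D → IsSymOf (suc k) KAdj D → EHT k D
  treeJoin : ∀ (T : Tree) (xs : List ℕ) (Ds : Fin (length (TE T)) → Digraph) D →
             (∀ i → EHT k (Ds i)) → IsTreeJoin T xs Ds D → EHT k D

-- Directed Hajós join of vertex-disjoint D₁, D₂ along uv₁ ∈ A(D₁), v₂w ∈ A(D₂);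
-- the identified vertex is labelled v₁.

rename : ℕ → ℕ → ℕ → ℕ
rename v₂ v₁ x = if does (x ≟ v₂) then v₁ else x

IsHajosJoin : Digraph → Digraph → ℕ → ℕ → ℕ → ℕ → Digraph → Set
IsHajosJoin D₁ D₂ u v₁ v₂ w D =
  (∀ x → x ∈ V D ⇔′ (x ∈ V D₁ ⊎ (x ∈ V D₂ × x ≢ v₂))) ×
  (∀ a → a ∈ A D ⇔′
     ((a ∈ A D₁ × a ≢ (u , v₁)) ⊎
      (∃[ b ] (b ∈ A D₂ × b ≢ (v₂ , w) ×
               a ≡ (rename v₂ v₁ (proj₁ b) , rename v₂ v₁ (proj₂ b)))) ⊎
      a ≡ (u , w)))

module Submission where

-- A digraph of the class is either symmetric, and then the tree join of itself along a single
-- edge u–v with cycle u → v → u, or a tree join.  Hence the arc uv₁ of D₁ either lies on the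
-- cycle of a tree-join representation of D₁, or inside a component, off its digon; in the latter
-- case the Hajós join can be carried out inside that component (induction on the derivation).
-- The same holds for v₂w in D₂.  When both arcs lie on the cycles, gluing the two trees at the
-- identified vertex and splicing the two cycles through the new arc uw exhibits the Hajós join
-- as one extended Hajós tree join.  Renaming by the transposition of v₁ and v₂ first reduces to
-- joins in which the identified vertex keeps its name.


open import Defs
open import Data.Bool using (if_then_else_)
open import Data.Empty using (⊥; ⊥-elim)
open import Data.Fin as Fin using (Fin; zero; suc)
import Data.Fin.Properties as Fin
open import Data.List using (List; []; _∷_; [_]; _++_; length; filter; map; lookup; deduplicate)
open import Data.List.Membership.Propositional using (_∈_; _∉_)
open import Data.List.Membership.Propositional.Properties
  using (∈-map⁺; ∈-map⁻; ∈-∃++; ∈-lookup; ∈-++⁺ˡ; ∈-++⁺ʳ; ∈-++⁻; ∈-deduplicate⁺; ∈-deduplicate⁻; ∈-filter⁺; ∈-filter⁻)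
open import Data.List.Properties
  using (++-assoc; ++-identityʳ; map-++; length-map; filter-accept; filter-reject; filter-some; filter-none;
         filter-++; length-++; concatMap-++; ∷-injective)
open import Data.List.Relation.Binary.Permutation.Propositional
  using (_↭_; ↭-refl; ↭-reflexive; ↭-trans; ↭-sym; ↭⇒↭ₛ)
open import Data.List.Relation.Binary.Permutation.Propositional.Properties as Perm
  using (∷↭∷ʳ; filter-↭; ↭-length; ∈-resp-↭; All-resp-↭; map⁺)
open import Data.List.Relation.Binary.Permutation.Setoid.Properties using (Unique-resp-↭)
open import Data.List.Relation.Binary.Sublist.Propositional using (_⊆_; []; _∷_; _∷ʳ_)
open import Data.List.Relation.Binary.Sublist.Propositional.Properties as Sublist
  using (++⁺; ++⁺ʳ; filter⁺; length-mono-≤; Any-resp-⊆)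
open import Data.List.Relation.Unary.All as All using (All; []; _∷_)
import Data.List.Relation.Unary.All.Properties as All
open import Data.List.Relation.Unary.All.Properties.Core using (¬Any⇒All¬; All¬⇒¬Any)
open import Data.List.Relation.Unary.AllPairs using ([]; _∷_)
open import Data.List.Relation.Unary.Any as Any using (here; there)
open import Data.List.Relation.Unary.Any.Properties using (lookup-index)
open import Data.List.Relation.Unary.Unique.DecPropositional.Properties as UniqueDec using ()
open import Data.List.Relation.Unary.Unique.Propositional using (Unique)
open import Data.List.Relation.Unary.Unique.Propositional.Properties as Unique using (Unique[x∷xs]⇒x∉xs)
open import Data.Nat using (ℕ; zero; suc; _+_; _≤_; z≤n; s≤s)
open import Data.Nat.Properties using (_≟_; ≤-trans; ≤-refl; ≤-reflexive; +-mono-≤; m≤m+n; m≤n⇒m≤1+n; +-identityʳ)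
open import Data.List.Membership.DecPropositional _≟_ using (_∈?_)
open import Data.Product using (Σ; ∃₂; ∃-syntax; Σ-syntax; _×_; _,_; proj₁; proj₂)
open import Data.Product.Properties using (≡-dec)
open import Data.Sum as Sum using (_⊎_; inj₁; inj₂; [_,_]′)
open import Function using (_∘_)
open import Relation.Binary.PropositionalEquality
  using (_≡_; _≢_; refl; sym; trans; cong; cong₂; subst; subst₂; setoid; module ≡-Reasoning)
open import Relation.Nullary using (¬_; ¬?; yes; no; Dec; contradiction)
open import Relation.Nullary.Decidable using (_⊎-dec_; dec-true; dec-false)
open import Relation.Unary using (Decidable)

-- Cyclic arc lists and rotations

pathArcs : List ℕ → List Arc
pathArcs [] = []
pathArcs (x ∷ []) = []
pathArcs (x ∷ y ∷ r) = (x , y) ∷ pathArcs (y ∷ r)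

cyclicGo-pathArcs : ∀ f l → cyclicGo f l ≡ pathArcs (l ++ [ f ])
cyclicGo-pathArcs f [] = refl
cyclicGo-pathArcs f (x ∷ []) = refl
cyclicGo-pathArcs f (x ∷ y ∷ r) = cong ((x , y) ∷_) (cyclicGo-pathArcs f (y ∷ r))

cyclicArcs-pathArcs : ∀ x r → cyclicArcs (x ∷ r) ≡ pathArcs (x ∷ r ++ [ x ])
cyclicArcs-pathArcs x r = cyclicGo-pathArcs x (x ∷ r)

pathArcs-++ : ∀ l x m → pathArcs (l ++ x ∷ m) ≡ pathArcs (l ++ [ x ]) ++ pathArcs (x ∷ m)
pathArcs-++ [] x m = refl
pathArcs-++ (a ∷ []) x m = refl
pathArcs-++ (a ∷ b ∷ l) x m = cong ((a , b) ∷_) (pathArcs-++ (b ∷ l) x m)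

map-proj₁-pathArcs : ∀ l y → map proj₁ (pathArcs (l ++ [ y ])) ≡ l
map-proj₁-pathArcs [] y = refl
map-proj₁-pathArcs (a ∷ []) y = refl
map-proj₁-pathArcs (a ∷ b ∷ l) y = cong (a ∷_) (map-proj₁-pathArcs (b ∷ l) y)

map-proj₁-cyclicArcs : ∀ l → map proj₁ (cyclicArcs l) ≡ l
map-proj₁-cyclicArcs [] = refl
map-proj₁-cyclicArcs (x ∷ r) = trans (cong (map proj₁) (cyclicArcs-pathArcs x r)) (map-proj₁-pathArcs (x ∷ r) x)

Unique-cyclicArcs : ∀ {l} → Unique l → Unique (cyclicArcs l)
Unique-cyclicArcs {l} u = Unique.map⁻ (subst Unique (sym (map-proj₁-cyclicArcs l)) u)

module _ {A : Set} where

  data Rotation : List A → List A → Set where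
    rot-refl : ∀ {l} → Rotation l l
    rot-step : ∀ {x r l} → Rotation (r ++ [ x ]) l → Rotation (x ∷ r) l

  rotation-trans : ∀ {a b c} → Rotation a b → Rotation b c → Rotation a c
  rotation-trans rot-refl q = q
  rotation-trans (rot-step p) q = rot-step (rotation-trans p q)

  ++-rotation : ∀ P Q → Rotation (P ++ Q) (Q ++ P)
  ++-rotation [] Q = subst (Rotation Q) (sym (++-identityʳ Q)) rot-refl
  ++-rotation (p ∷ P) Q =
    rot-step (subst₂ Rotation (sym (++-assoc P Q [ p ])) (++-assoc Q [ p ] P) (++-rotation P (Q ++ [ p ])))

  Rotation⇒↭ : ∀ {a b} → Rotation a b → a ↭ b
  Rotation⇒↭ rot-refl = ↭-refl
  Rotation⇒↭ {x ∷ r} (rot-step p) = ↭-trans (∷↭∷ʳ x r) (Rotation⇒↭ p)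

  Unique-resp-Rotation : ∀ {a b} → Rotation a b → Unique a → Unique b
  Unique-resp-Rotation r = Unique-resp-↭ (setoid A) (↭⇒↭ₛ (Rotation⇒↭ r))

  ⊆-split-head : ∀ {x r L} → (x ∷ r) ⊆ L → Σ[ pre ∈ List A ] Σ[ rest ∈ List A ] (L ≡ pre ++ x ∷ rest × r ⊆ rest)
  ⊆-split-head (y ∷ʳ p) with ⊆-split-head p
  ... | pre , rest , refl , q = y ∷ pre , rest , refl , q
  ⊆-split-head {L = y ∷ L} (refl ∷ p) = [] , L , refl , p

  ⊆-resp-Rotation : ∀ {xs xs' L : List A} → xs ⊆ L → Rotation xs xs' → ∃[ L' ] (Rotation L L' × xs' ⊆ L')
  ⊆-resp-Rotation {L = L} s rot-refl = L , rot-refl , s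
  ⊆-resp-Rotation {x ∷ r} s (rot-step p) with ⊆-split-head s
  ... | pre , rest , refl , q with ⊆-resp-Rotation (++⁺ (++⁺ʳ pre q) (refl ∷ [])) p
  ...   | L' , rL , s' = L' , rotation-trans (++-rotation pre (x ∷ rest)) (rot-step rL) , s'

cyclicArcs-rotate : ∀ x r → cyclicArcs (x ∷ r) ↭ cyclicArcs (r ++ [ x ])
cyclicArcs-rotate x [] = ↭-refl
cyclicArcs-rotate x (y ∷ r) = ↭-trans (∷↭∷ʳ (x , y) (cyclicGo x (y ∷ r))) (↭-reflexive rotated)
  where
  open ≡-Reasoning
  rotated : cyclicGo x (y ∷ r) ++ [ (x , y) ] ≡ cyclicArcs (y ∷ r ++ [ x ])
  rotated = begin
    cyclicGo x (y ∷ r) ++ [ (x , y) ]        ≡⟨ cong (_++ [ (x , y) ]) (cyclicGo-pathArcs x (y ∷ r)) ⟩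
    pathArcs (y ∷ r ++ [ x ]) ++ [ (x , y) ] ≡⟨ pathArcs-++ (y ∷ r) x [ y ] ⟨
    pathArcs (y ∷ r ++ x ∷ [ y ])            ≡⟨ cong pathArcs (++-assoc (y ∷ r) [ x ] [ y ]) ⟨
    pathArcs (y ∷ (r ++ [ x ]) ++ [ y ])     ≡⟨ cyclicArcs-pathArcs y (r ++ [ x ]) ⟨
    cyclicArcs (y ∷ r ++ [ x ])              ∎

cyclicArcs-resp-Rotation : ∀ {a b} → Rotation a b → cyclicArcs a ↭ cyclicArcs b
cyclicArcs-resp-Rotation rot-refl = ↭-refl
cyclicArcs-resp-Rotation {x ∷ r} (rot-step p) = ↭-trans (cyclicArcs-rotate x r) (cyclicArcs-resp-Rotation p)

∈-pathArcs⁻ : ∀ l {a b} → (a , b) ∈ pathArcs l → ∃₂ λ pre post → l ≡ pre ++ a ∷ b ∷ post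
∈-pathArcs⁻ (x ∷ y ∷ r) (here refl) = [] , r , refl
∈-pathArcs⁻ (x ∷ y ∷ r) (there p) with ∈-pathArcs⁻ (y ∷ r) p
... | pre , post , eq = x ∷ pre , post , cong (x ∷_) eq

∷ʳ-split : ∀ l x pre a b post → l ++ [ x ] ≡ pre ++ a ∷ b ∷ post →
           Σ[ m ∈ List ℕ ] (l ≡ pre ++ a ∷ m × m ++ [ x ] ≡ b ∷ post)
∷ʳ-split (l₁ ∷ l) x [] a b post eq with ∷-injective eq
... | refl , eq′ = l , refl , eq′
∷ʳ-split (l₁ ∷ l) x (q ∷ pre) a b post eq with ∷-injective eq
... | refl , eq′ with ∷ʳ-split l x pre a b post eq′
...   | m , refl , eq″ = m , refl , eq″
∷ʳ-split [] x [] a b post ()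
∷ʳ-split [] x (_ ∷ []) a b post ()
∷ʳ-split [] x (_ ∷ _ ∷ _) a b post ()

∈-cyclicArcs⁻ : ∀ xs {a b} → a ≢ b → (a , b) ∈ cyclicArcs xs → ∃[ r ] Rotation xs (a ∷ b ∷ r)
∈-cyclicArcs⁻ (x ∷ r) {a} {b} a≢b p =
  fromSplit r (∈-pathArcs⁻ (x ∷ r ++ [ x ]) (subst ((a , b) ∈_) (cyclicArcs-pathArcs x r) p))
  where
  fromSnoc : ∀ pre m post → m ++ [ x ] ≡ b ∷ post → ∃[ r′ ] Rotation (x ∷ pre ++ a ∷ m) (a ∷ b ∷ r′)
  fromSnoc pre [] _ refl = pre , ++-rotation (x ∷ pre) [ a ]
  fromSnoc pre (m₁ ∷ m) _ refl = m ++ x ∷ pre , ++-rotation (x ∷ pre) (a ∷ m₁ ∷ m)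
  fromSplit : ∀ r → (∃₂ λ pre post → x ∷ r ++ [ x ] ≡ pre ++ a ∷ b ∷ post) → ∃[ r′ ] Rotation (x ∷ r) (a ∷ b ∷ r′)
  fromSplit [] ([] , _ , refl) = ⊥-elim (a≢b refl)
  fromSplit (_ ∷ r) ([] , _ , refl) = r , rot-refl
  fromSplit r (q ∷ pre , post , eq) with ∷-injective eq
  ... | refl , eq′ with ∷ʳ-split r x pre a b post eq′
  ...   | m , refl , eq″ = fromSnoc pre m post eq″

∈-cyclicArcs⇒∈ : ∀ xs {a b} → a ≢ b → (a , b) ∈ cyclicArcs xs → a ∈ xs × b ∈ xs
∈-cyclicArcs⇒∈ xs a≢b p with ∈-cyclicArcs⁻ xs a≢b p
... | _ , rot = ∈-resp-↭ (↭-sym (Rotation⇒↭ rot)) (here refl)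
              , ∈-resp-↭ (↭-sym (Rotation⇒↭ rot)) (there (here refl))

occ-here : ∀ x l → occ x (x ∷ l) ≡ suc (occ x l)
occ-here x l = cong length (filter-accept (_≟ x) refl)

occ-there : ∀ {x y} l → y ≢ x → occ x (y ∷ l) ≡ occ x l
occ-there l y≢x = cong length (filter-reject (_≟ _) y≢x)

occ-∉ : ∀ {x} l → x ∉ l → occ x l ≡ 0
occ-∉ l x∉l = cong length (filter-none (_≟ _) (¬Any⇒All¬ l (λ p → x∉l (Any.map sym p))))

occ-∈ : ∀ {x} l → x ∈ l → 1 ≤ occ x l
occ-∈ l x∈l = filter-some (_≟ _) (Any.map sym x∈l)

occ-mono-⊆ : ∀ {x} {xs ys : List ℕ} → xs ⊆ ys → occ x xs ≤ occ x ys
occ-mono-⊆ τ = length-mono-≤ (filter⁺ (_≟ _) (_≟ _) (λ { refl p → p }) τ)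

occ-resp-↭ : ∀ {x} {a b : List ℕ} → a ↭ b → occ x a ≡ occ x b
occ-resp-↭ {x} p = ↭-length (filter-↭ (_≟ x) p)

Unique⇒occ≤1 : ∀ {l} → Unique l → ∀ x → occ x l ≤ 1
Unique⇒occ≤1 [] x = z≤n
Unique⇒occ≤1 {y ∷ l} (y∉l ∷ u) x with y ≟ x
... | yes refl = subst (_≤ 1) (sym (trans (occ-here x l) (cong suc (occ-∉ l (All¬⇒¬Any y∉l))))) ≤-refl
... | no y≢x = subst (_≤ 1) (sym (occ-there l y≢x)) (Unique⇒occ≤1 u x)

occ≤1⇒Unique : ∀ l → (∀ x → occ x l ≤ 1) → Unique l
occ≤1⇒Unique [] _ = []
occ≤1⇒Unique (y ∷ l) h = ¬Any⇒All¬ l y∉l ∷ occ≤1⇒Unique l h′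
  where
  y∉l : y ∉ l
  y∉l m with subst (_≤ 1) (occ-here y l) (h y) | occ-∈ l m
  ... | s≤s o≤0 | 1≤o = contradiction (≤-trans 1≤o o≤0) λ ()
  h′ : ∀ x → occ x l ≤ 1
  h′ x with y ≟ x
  ... | yes refl = ≤-trans (m≤n⇒m≤1+n ≤-refl) (subst (_≤ 1) (occ-here x l) (h x))
  ... | no y≢x = subst (_≤ 1) (occ-there l y≢x) (h x)

∈-symArcs⁻ : ∀ E {x y} → (x , y) ∈ symArcs E → (x , y) ∈ E ⊎ (y , x) ∈ E
∈-symArcs⁻ ((a , b) ∷ E) (here refl) = inj₁ (here refl)
∈-symArcs⁻ ((a , b) ∷ E) (there (here refl)) = inj₂ (here refl)
∈-symArcs⁻ (e ∷ E) (there (there p)) = Sum.map there there (∈-symArcs⁻ E p)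

symArcs-++ : ∀ E₁ E₂ → symArcs (E₁ ++ E₂) ≡ symArcs E₁ ++ symArcs E₂
symArcs-++ = concatMap-++ (λ e → e ∷ Data.Product.swap e ∷ [])

symArcs-TV : ∀ (T : Tree) {x y} → (x , y) ∈ symArcs (TE T) → x ∈ TV T × y ∈ TV T
symArcs-TV T p with ∈-symArcs⁻ (TE T) p
... | inj₁ q = TE-in-V T q
... | inj₂ q = Data.Product.swap (TE-in-V T q)

symArcs-loopless : ∀ (T : Tree) {x} → (x , x) ∉ symArcs (TE T)
symArcs-loopless T p with ∈-symArcs⁻ (TE T) p
... | inj₁ q = TE-loopless T q
... | inj₂ q = TE-loopless T q

Reach-mono : ∀ {E₁ E₂ x y} → (∀ {a} → a ∈ symArcs E₁ → a ∈ symArcs E₂) → Reach E₁ x y → Reach E₂ x y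
Reach-mono f here = here
Reach-mono f (step p r) = step (f p) (Reach-mono f r)

Reach-trans : ∀ {E x y z} → Reach E x y → Reach E y z → Reach E x z
Reach-trans here q = q
Reach-trans (step p r) q = step p (Reach-trans r q)

Incident : ℕ → Arc → Set
Incident v (a , b) = a ≡ v ⊎ b ≡ v

incident? : ∀ v → Decidable (Incident v)
incident? v e = (proj₁ e ≟ v) ⊎-dec (proj₂ e ≟ v)

degE : List Arc → ℕ → ℕ
degE E v = length (filter (incident? v) E)

degE-incident : ∀ {v a b} E → Incident v (a , b) → degE ((a , b) ∷ E) v ≡ suc (degE E v)
degE-incident {v} E i = cong length (filter-accept (incident? v) i)

degE-nonincident : ∀ {v a b} E → ¬ Incident v (a , b) → degE ((a , b) ∷ E) v ≡ degE E v
degE-nonincident {v} E ¬i = cong length (filter-reject (incident? v) ¬i)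

degE-++ : ∀ E₁ E₂ x → degE (E₁ ++ E₂) x ≡ degE E₁ x + degE E₂ x
degE-++ E₁ E₂ x = trans (cong length (filter-++ (incident? x) E₁ E₂)) (length-++ (filter (incident? x) E₁))

deg-∉ : ∀ (T : Tree) {x} → x ∉ TV T → deg T x ≡ 0
deg-∉ T {x} x∉T = cong length (filter-none (incident? x) (All.tabulate λ where
  m (inj₁ refl) → x∉T (proj₁ (TE-in-V T m))
  m (inj₂ refl) → x∉T (proj₂ (TE-in-V T m))))

deg-positive : ∀ (T : Tree) {x y} → x ∈ TV T → y ∈ TV T → x ≢ y → 1 ≤ deg T x
deg-positive T {x} x∈T y∈T x≢y with connected T x∈T y∈T
... | here = ⊥-elim (x≢y refl)
... | step p _ = filter-some (incident? x) (Sum.[ (λ q → Any.map (λ { refl → inj₁ refl }) q)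
                                                , (λ q → Any.map (λ { refl → inj₂ refl }) q) ]′ (∈-symArcs⁻ (TE T) p))

occ-symArcs : ∀ E x → All (λ e → proj₁ e ≢ proj₂ e) E → occ x (map proj₁ (symArcs E)) ≡ degE E x
occ-symArcs [] x _ = refl
occ-symArcs ((a , b) ∷ E) x (a≢b ∷ E-loopless) with a ≟ x | b ≟ x
... | yes refl | yes refl = ⊥-elim (a≢b refl)
... | yes refl | no b≢x = begin
  occ x (x ∷ b ∷ rest) ≡⟨ occ-here x (b ∷ rest) ⟩
  suc (occ x (b ∷ rest)) ≡⟨ cong suc (occ-there rest b≢x) ⟩
  suc (occ x rest) ≡⟨ cong suc (occ-symArcs E x E-loopless) ⟩
  suc (degE E x) ≡⟨ degE-incident {b = b} E (inj₁ refl) ⟨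
  degE ((x , b) ∷ E) x ∎
  where
  open ≡-Reasoning
  rest : List ℕ
  rest = map proj₁ (symArcs E)
... | no a≢x | yes refl = begin
  occ x (a ∷ x ∷ rest) ≡⟨ occ-there (x ∷ rest) a≢x ⟩
  occ x (x ∷ rest) ≡⟨ occ-here x rest ⟩
  suc (occ x rest) ≡⟨ cong suc (occ-symArcs E x E-loopless) ⟩
  suc (degE E x) ≡⟨ degE-incident {a = a} E (inj₂ refl) ⟨
  degE ((a , x) ∷ E) x ∎
  where
  open ≡-Reasoning
  rest : List ℕ
  rest = map proj₁ (symArcs E)
... | no a≢x | no b≢x = begin
  occ x (a ∷ b ∷ rest) ≡⟨ occ-there (b ∷ rest) a≢x ⟩
  occ x (b ∷ rest) ≡⟨ occ-there rest b≢x ⟩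
  occ x rest ≡⟨ occ-symArcs E x E-loopless ⟩
  degE E x ≡⟨ degE-nonincident E (Sum.[ a≢x , b≢x ]′) ⟨
  degE ((a , b) ∷ E) x ∎
  where
  open ≡-Reasoning
  rest : List ℕ
  rest = map proj₁ (symArcs E)

occ-Eulerian : ∀ (T : Tree) {L} x → EulerianList T L → occ x L ≡ deg T x
occ-Eulerian T {L} x eul = begin
  occ x L                                  ≡⟨ cong (occ x) (map-proj₁-cyclicArcs L) ⟨
  occ x (map proj₁ (cyclicArcs L))         ≡⟨ occ-resp-↭ (map⁺ proj₁ eul) ⟩
  occ x (map proj₁ (symArcs (TE T)))       ≡⟨ occ-symArcs (TE T) x (All.tabulate λ { m refl → TE-loopless T m }) ⟩
  deg T x                                  ∎
  where open ≡-Reasoning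

∈-Eulerian⇒∈TV : ∀ (T : Tree) {L x} → EulerianList T L → x ∈ L → x ∈ TV T
∈-Eulerian⇒∈TV T {L} eul x∈L with ∈-map⁻ proj₁ (subst (_ ∈_) (sym (map-proj₁-cyclicArcs L)) x∈L)
... | _ , a∈L , refl = proj₁ (symArcs-TV T (∈-resp-↭ eul a∈L))

PartialEulerian⇒⊆Eulerian : ∀ (T : Tree) {xs} → PartialEulerianList T xs → ∃[ L ] (EulerianList T L × xs ⊆ L)
PartialEulerian⇒⊆Eulerian T ((_ , eul , P , Q , refl , xs⊆QP) , _) =
  Q ++ P , ↭-trans (↭-sym (cyclicArcs-resp-Rotation (++-rotation P Q))) eul , xs⊆QP

∈-PartialEulerian⇒∈TV : ∀ (T : Tree) {xs x} → PartialEulerianList T xs → x ∈ xs → x ∈ TV T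
∈-PartialEulerian⇒∈TV T pe x∈xs with PartialEulerian⇒⊆Eulerian T pe
... | L , eul , xs⊆L = ∈-Eulerian⇒∈TV T eul (Any-resp-⊆ xs⊆L x∈xs)

-- Leaves occur once in every Eulerian list, the other vertices at most once by definition.
PartialEulerian⇒Unique : ∀ (T : Tree) {xs} → PartialEulerianList T xs → Unique xs
PartialEulerian⇒Unique T {xs} pe@(_ , _ , inner≤1) = occ≤1⇒Unique xs occ≤1
  where
  occ≤1 : ∀ x → occ x xs ≤ 1
  occ≤1 x with x ∈? xs
  ... | no x∉xs = subst (_≤ 1) (sym (occ-∉ xs x∉xs)) z≤n
  ... | yes x∈xs with deg T x ≟ 1
  ...   | no ¬leaf = inner≤1 x (∈-PartialEulerian⇒∈TV T pe x∈xs) (λ leaf → ¬leaf (proj₂ leaf))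
  ...   | yes leaf with PartialEulerian⇒⊆Eulerian T pe
  ...     | L , eul , xs⊆L = ≤-trans (occ-mono-⊆ xs⊆L) (≤-reflexive (trans (occ-Eulerian T {L} x eul) leaf))

TV⇒endpoint : ∀ (T : Tree) → 1 ≤ length (TE T) → ∀ {x} → x ∈ TV T →
              ∃[ i ] (x ≡ eu T i ⊎ x ≡ ev T i)
TV⇒endpoint T nonempty {x} x∈T = fromEdges (TE T) refl nonempty
  where
  fromArc : ∀ {y} → (x , y) ∈ symArcs (TE T) → ∃[ i ] (x ≡ eu T i ⊎ x ≡ ev T i)
  fromArc p with ∈-symArcs⁻ (TE T) p
  ... | inj₁ q = Any.index q , inj₁ (cong proj₁ (lookup-index q))
  ... | inj₂ q = Any.index q , inj₂ (cong proj₂ (lookup-index q))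
  fromEdges : ∀ E → E ≡ TE T → 1 ≤ length E → ∃[ i ] (x ≡ eu T i ⊎ x ≡ ev T i)
  fromEdges ((a , b) ∷ E) refl _ with connected T x∈T (proj₁ (TE-in-V T (here refl)))
  ... | here = fromArc (here refl)
  ... | step p _ = fromArc p

Endpoint : ℕ → ℕ → ℕ → Set
Endpoint e₁ e₂ x = x ≡ e₁ ⊎ x ≡ e₂

InDigon-endpoints : ∀ {e₁ e₂ x y} → InDigon e₁ e₂ (x , y) → Endpoint e₁ e₂ x × Endpoint e₁ e₂ y
InDigon-endpoints (inj₁ refl) = inj₁ refl , inj₂ refl
InDigon-endpoints (inj₂ refl) = inj₂ refl , inj₁ refl

endpoints⇒InDigon : ∀ {e₁ e₂ x y} → x ≢ y → Endpoint e₁ e₂ x → Endpoint e₁ e₂ y → InDigon e₁ e₂ (x , y)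
endpoints⇒InDigon x≢y (inj₁ refl) (inj₁ refl) = ⊥-elim (x≢y refl)
endpoints⇒InDigon x≢y (inj₁ refl) (inj₂ refl) = inj₁ refl
endpoints⇒InDigon x≢y (inj₂ refl) (inj₁ refl) = inj₂ refl
endpoints⇒InDigon x≢y (inj₂ refl) (inj₂ refl) = ⊥-elim (x≢y refl)

endpoint-TV : ∀ (T : Tree) i {x} → Endpoint (eu T i) (ev T i) x → x ∈ TV T
endpoint-TV T i (inj₁ refl) = proj₁ (TE-in-V T (∈-lookup {xs = TE T} i))
endpoint-TV T i (inj₂ refl) = proj₂ (TE-in-V T (∈-lookup {xs = TE T} i))

module TreeJoin (T : Tree) (xs : List ℕ) (Ds : Fin (length (TE T)) → Digraph) (D : Digraph)
                (tj : IsTreeJoin T xs Ds D) where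

  nonempty : 1 ≤ length (TE T)
  nonempty = proj₁ tj

  partialEulerian : PartialEulerianList T xs
  partialEulerian = proj₁ (proj₂ tj)

  tree-vertices : ∀ i x → (x ∈ V (Ds i) × x ∈ TV T) ⇔′ Endpoint (eu T i) (ev T i) x
  tree-vertices = proj₁ (proj₂ (proj₂ tj))

  digons : ∀ i → (eu T i , ev T i) ∈ A (Ds i) × (ev T i , eu T i) ∈ A (Ds i)
  digons = proj₁ (proj₂ (proj₂ (proj₂ tj)))

  disjoint-interiors : ∀ i j → i ≢ j → ∀ x → x ∈ V (Ds i) → x ∈ V (Ds j) →
                       ¬ Endpoint (eu T i) (ev T i) x → ¬ Endpoint (eu T j) (ev T j) x → ⊥
  disjoint-interiors = proj₁ (proj₂ (proj₂ (proj₂ (proj₂ tj))))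

  vertices : ∀ x → x ∈ V D ⇔′ ((∃[ i ] x ∈ V (Ds i)) ⊎ x ∈ xs)
  vertices = proj₁ (proj₂ (proj₂ (proj₂ (proj₂ (proj₂ tj)))))

  arcs : ∀ a → a ∈ A D ⇔′ ((∃[ i ] (a ∈ A (Ds i) × ¬ InDigon (eu T i) (ev T i) a)) ⊎ a ∈ cyclicArcs xs)
  arcs = proj₂ (proj₂ (proj₂ (proj₂ (proj₂ (proj₂ tj)))))

  xs⊆TV : ∀ {x} → x ∈ xs → x ∈ TV T
  xs⊆TV = ∈-PartialEulerian⇒∈TV T partialEulerian

  xs-unique : Unique xs
  xs-unique = PartialEulerian⇒Unique T partialEulerian

  endpoint : ∀ i {x} → x ∈ V (Ds i) → x ∈ TV T → Endpoint (eu T i) (ev T i) x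
  endpoint i x∈Dᵢ x∈T = proj₁ (tree-vertices i _) (x∈Dᵢ , x∈T)

  endpoint-∈ : ∀ i {x} → Endpoint (eu T i) (ev T i) x → x ∈ V (Ds i)
  endpoint-∈ i e = proj₁ (proj₂ (tree-vertices i _) e)

  Ds⊆V : ∀ i {x} → x ∈ V (Ds i) → x ∈ V D
  Ds⊆V i x∈Dᵢ = proj₂ (vertices _) (inj₁ (i , x∈Dᵢ))

  xs⊆V : ∀ {x} → x ∈ xs → x ∈ V D
  xs⊆V x∈xs = proj₂ (vertices _) (inj₂ x∈xs)

  TV⊆V : ∀ {x} → x ∈ TV T → x ∈ V D
  TV⊆V x∈T with TV⇒endpoint T nonempty x∈T
  ... | i , e = Ds⊆V i (endpoint-∈ i e)

  arc-between-tree-vertices : ∀ j {a b} → (a , b) ∈ A (Ds j) → a ∈ TV T → b ∈ TV T → a ≢ b →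
                              InDigon (eu T j) (ev T j) (a , b)
  arc-between-tree-vertices j ab∈D a∈T b∈T a≢b =
    endpoints⇒InDigon a≢b (endpoint j (proj₁ (A-in-V (Ds j) ab∈D)) a∈T) (endpoint j (proj₂ (A-in-V (Ds j) ab∈D)) b∈T)

  InDigon⇒∈V : ∀ j {a b} → InDigon (eu T j) (ev T j) (a , b) → a ∈ V D × b ∈ V D
  InDigon⇒∈V j d with InDigon-endpoints d
  ... | ea , eb = TV⊆V (endpoint-TV T j ea) , TV⊆V (endpoint-TV T j eb)

  shared-endpoint : ∀ i j → i ≢ j → ∀ {x} → x ∈ V (Ds i) → x ∈ V (Ds j) → Endpoint (eu T j) (ev T j) x
  shared-endpoint i j i≢j {x} x∈Dᵢ x∈Dⱼ with x ≟ eu T i | x ≟ ev T i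
  ... | yes refl | _ = endpoint j x∈Dⱼ (endpoint-TV T i (inj₁ refl))
  ... | no _ | yes refl = endpoint j x∈Dⱼ (endpoint-TV T i (inj₂ refl))
  ... | no ¬u | no ¬v with x ≟ eu T j | x ≟ ev T j
  ...   | yes e | _ = inj₁ e
  ...   | no _ | yes e = inj₂ e
  ...   | no ¬u′ | no ¬v′ = ⊥-elim (disjoint-interiors i j i≢j x x∈Dᵢ x∈Dⱼ Sum.[ ¬u , ¬v ]′ Sum.[ ¬u′ , ¬v′ ]′)

cyclicArcs-source : ∀ {P : Arc → Set} {c x} → All P (cyclicArcs c) → x ∈ c → ∃[ y ] P (x , y)
cyclicArcs-source {c = c} all x∈c with ∈-map⁻ proj₁ (subst (_ ∈_) (sym (map-proj₁-cyclicArcs c)) x∈c)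
... | (_ , y) , a∈c , refl = y , All.lookup all a∈c

module _ {a b : ℕ} (a≢b : a ≢ b) where

  private
    arc-endpoint : ∀ {x y} → (x , y) ∈ symArcs [ (a , b) ] → Endpoint a b x
    arc-endpoint (here refl) = inj₁ refl
    arc-endpoint (there (here refl)) = inj₂ refl

    no-three-endpoints : ∀ {x y z} → x ≢ y → x ≢ z → y ≢ z →
                         Endpoint a b x → Endpoint a b y → Endpoint a b z → ⊥
    no-three-endpoints x≢y _ _ (inj₁ refl) (inj₁ refl) _ = x≢y refl
    no-three-endpoints x≢y _ _ (inj₂ refl) (inj₂ refl) _ = x≢y refl
    no-three-endpoints _ x≢z _ (inj₁ refl) (inj₂ refl) (inj₁ refl) = x≢z refl
    no-three-endpoints _ _ y≢z (inj₁ refl) (inj₂ refl) (inj₂ refl) = y≢z refl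
    no-three-endpoints _ _ y≢z (inj₂ refl) (inj₁ refl) (inj₁ refl) = y≢z refl
    no-three-endpoints _ x≢z _ (inj₂ refl) (inj₁ refl) (inj₂ refl) = x≢z refl

    acyclic-edge : ∀ c → Unique c → 3 ≤ length c → ¬ All (_∈ symArcs [ (a , b) ]) (cyclicArcs c)
    acyclic-edge [] _ ()
    acyclic-edge (_ ∷ []) _ (s≤s ())
    acyclic-edge (_ ∷ _ ∷ []) _ (s≤s (s≤s ()))
    acyclic-edge (x ∷ y ∷ z ∷ r) ((x≢y ∷ x≢z ∷ _) ∷ (y≢z ∷ _) ∷ _) _ all =
      no-three-endpoints x≢y x≢z y≢z (onEdge (here refl)) (onEdge (there (here refl)))
                                     (onEdge (there (there (here refl))))
      where
      onEdge : ∀ {w} → w ∈ x ∷ y ∷ z ∷ r → Endpoint a b w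
      onEdge w∈c = arc-endpoint (proj₂ (cyclicArcs-source all w∈c))

    connected-edge : ∀ {x y} → x ∈ a ∷ b ∷ [] → y ∈ a ∷ b ∷ [] → Reach [ (a , b) ] x y
    connected-edge (here refl) (here refl) = here
    connected-edge (here refl) (there (here refl)) = step (here refl) here
    connected-edge (there (here refl)) (here refl) = step (there (here refl)) here
    connected-edge (there (here refl)) (there (here refl)) = here

  edgeTree : Tree
  edgeTree = record
    { TV = a ∷ b ∷ []
    ; TE = [ (a , b) ]
    ; TV-unique = (a≢b ∷ []) ∷ [] ∷ []
    ; TE-in-V = λ { (here refl) → here refl , there (here refl) }
    ; TE-loopless = λ { (here refl) → a≢b refl }
    ; TE-simple = ((λ ab≡ba → a≢b (cong proj₁ ab≡ba)) ∷ []) ∷ [] ∷ []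
    ; connected = connected-edge
    ; acyclic = acyclic-edge
    }

  edgeTree-PartialEulerian : PartialEulerianList edgeTree (a ∷ b ∷ [])
  edgeTree-PartialEulerian =
      (a ∷ b ∷ [] , ↭-refl , [] , a ∷ b ∷ [] , refl , refl ∷ refl ∷ [])
    , (λ _ leaf → proj₁ leaf)
    , (λ v _ _ → Unique⇒occ≤1 ((a≢b ∷ []) ∷ [] ∷ []) v)

Symmetric : Digraph → Set
Symmetric D = ∀ {x y} → (x , y) ∈ A D → (y , x) ∈ A D

IsSymOf⇒Symmetric : ∀ {m adj D} → (∀ i j → adj i j → adj j i) → IsSymOf m adj D → Symmetric D
IsSymOf⇒Symmetric {D = D} adj-sym (f , _ , vertex , adjacent) {x} {y} xy∈D
  with proj₁ (vertex x) (proj₁ (A-in-V D xy∈D)) | proj₁ (vertex y) (proj₂ (A-in-V D xy∈D))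
... | i , refl | j , refl = proj₂ (adjacent j i) (adj-sym i j (proj₁ (adjacent i j) xy∈D))

WheelAdj-sym : ∀ ℓ i j → WheelAdj ℓ i j → WheelAdj ℓ j i
WheelAdj-sym ℓ i j (i≢j , rel) = (λ j≡i → i≢j (sym j≡i)) , flip-rel rel
  where
  flip-rel : ∀ {P Q R S : Set} → P ⊎ Q ⊎ R ⊎ S → Q ⊎ P ⊎ S ⊎ R
  flip-rel (inj₁ p) = inj₂ (inj₁ p)
  flip-rel (inj₂ (inj₁ q)) = inj₁ q
  flip-rel (inj₂ (inj₂ (inj₁ r))) = inj₂ (inj₂ (inj₂ r))
  flip-rel (inj₂ (inj₂ (inj₂ s))) = inj₂ (inj₂ (inj₁ s))

KAdj-sym : ∀ {m} (i j : Fin m) → KAdj i j → KAdj j i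
KAdj-sym i j i≢j j≡i = i≢j (sym j≡i)

record TreeJoinOf (k : ℕ) (D : Digraph) : Set where
  field
    tree : Tree
    cycle : List ℕ
    components : Fin (length (TE tree)) → Digraph
    components-EHT : ∀ i → EHT k (components i)
    isTreeJoin : IsTreeJoin tree cycle components D

-- The digon [u,v], removed from the single component D, is restored by the cycle u → v → u.
Symmetric⇒TreeJoinOf : ∀ {k D} → EHT k D → Symmetric D → ∀ {u v} → (u , v) ∈ A D →
                       Σ (TreeJoinOf k D) λ t → (u , v) ∈ cyclicArcs (TreeJoinOf.cycle t)
Symmetric⇒TreeJoinOf {k} {D} D∈EHT D-sym {u} {v} uv∈D = record
  { tree = edgeTree u≢v
  ; cycle = u ∷ v ∷ []
  ; components = λ _ → D
  ; components-EHT = λ _ → D∈EHT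
  ; isTreeJoin = s≤s z≤n , edgeTree-PartialEulerian u≢v , tree-vertices , (λ { zero → uv∈D , D-sym uv∈D })
               , (λ { zero zero 0≢0 → ⊥-elim (0≢0 refl) }) , vertices , arcs
  } , here refl
  where
  u≢v : u ≢ v
  u≢v refl = loopless D uv∈D
  u∈D : u ∈ V D
  u∈D = proj₁ (A-in-V D uv∈D)
  v∈D : v ∈ V D
  v∈D = proj₂ (A-in-V D uv∈D)
  T₀ : Tree
  T₀ = edgeTree u≢v
  tree-vertices : ∀ i x → (x ∈ V D × x ∈ u ∷ v ∷ []) ⇔′ Endpoint (eu T₀ i) (ev T₀ i) x
  tree-vertices zero x = (λ { (_ , here refl) → inj₁ refl ; (_ , there (here refl)) → inj₂ refl })
                       , (λ { (inj₁ refl) → u∈D , here refl ; (inj₂ refl) → v∈D , there (here refl) })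
  vertices : ∀ x → x ∈ V D ⇔′ ((∃[ i ] x ∈ V D) ⊎ x ∈ u ∷ v ∷ [])
  vertices x = (λ x∈D → inj₁ (zero , x∈D))
             , (λ { (inj₁ (_ , x∈D)) → x∈D ; (inj₂ (here refl)) → u∈D ; (inj₂ (there (here refl))) → v∈D })
  outside-digon : ∀ a → a ∈ A D → (∃[ i ] (a ∈ A D × ¬ InDigon (eu T₀ i) (ev T₀ i) a)) ⊎ a ∈ cyclicArcs (u ∷ v ∷ [])
  outside-digon a a∈D with ≡-dec _≟_ _≟_ a (u , v) | ≡-dec _≟_ _≟_ a (v , u)
  ... | yes refl | _ = inj₂ (here refl)
  ... | no _ | yes refl = inj₂ (there (here refl))
  ... | no a≢uv | no a≢vu = inj₁ (zero , a∈D , Sum.[ a≢uv , a≢vu ]′)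
  arcs : ∀ a → a ∈ A D ⇔′ ((∃[ i ] (a ∈ A D × ¬ InDigon (eu T₀ i) (ev T₀ i) a)) ⊎ a ∈ cyclicArcs (u ∷ v ∷ []))
  arcs a = outside-digon a
         , (λ { (inj₁ (_ , a∈D , _)) → a∈D ; (inj₂ (here refl)) → uv∈D ; (inj₂ (there (here refl))) → D-sym uv∈D })

rootEulerian : ∀ (T : Tree) {xs h R} → PartialEulerianList T xs → Rotation xs (h ∷ R) →
               ∃[ M ] (EulerianList T (h ∷ M) × R ⊆ M)
rootEulerian T {h = h} pe rot with PartialEulerian⇒⊆Eulerian T pe
... | L , eul , xs⊆L with ⊆-resp-Rotation xs⊆L rot
...   | L′ , L↻L′ , hR⊆L′ with ⊆-split-head hR⊆L′
...     | pre , rest , refl , R⊆rest =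
  rest ++ pre , eulerian , ++⁺ʳ pre R⊆rest
  where
  eulerian : EulerianList T (h ∷ rest ++ pre)
  eulerian = ↭-trans (↭-sym (cyclicArcs-resp-Rotation (++-rotation pre (h ∷ rest))))
                     (↭-trans (↭-sym (cyclicArcs-resp-Rotation L↻L′)) eul)

PartialEulerian-resp-Rotation : ∀ (T : Tree) {xs h R} → Rotation xs (h ∷ R) →
                                PartialEulerianList T xs → PartialEulerianList T (h ∷ R)
PartialEulerian-resp-Rotation T {xs} {h} {R} rot pe@(_ , leaves , inner≤1) with rootEulerian T pe rot
... | M , eul , R⊆M =
    (h ∷ M , eul , [] , h ∷ M , refl , subst ((h ∷ R) ⊆_) (sym (++-identityʳ (h ∷ M))) (refl ∷ R⊆M))
  , (λ v leaf → ∈-resp-↭ xs↭ (leaves v leaf))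
  , (λ v v∈T ¬leaf → subst (_≤ 1) (occ-resp-↭ xs↭) (inner≤1 v v∈T ¬leaf))
  where
  xs↭ : xs ↭ h ∷ R
  xs↭ = Rotation⇒↭ rot

IsTreeJoin-resp-Rotation : ∀ {T xs Ds D h R} → Rotation xs (h ∷ R) →
                           IsTreeJoin T xs Ds D → IsTreeJoin T (h ∷ R) Ds D
IsTreeJoin-resp-Rotation {T} {xs} {h = h} {R} rot (nonempty , pe , tree-vertices , digons , disjoint , vertices , arcs) =
    nonempty , PartialEulerian-resp-Rotation T rot pe , tree-vertices , digons , disjoint
  , (λ x → Sum.map₂ (∈-resp-↭ xs↭) ∘ proj₁ (vertices x) , proj₂ (vertices x) ∘ Sum.map₂ (∈-resp-↭ (↭-sym xs↭)))
  , (λ a → Sum.map₂ (∈-resp-↭ arcs↭) ∘ proj₁ (arcs a) , proj₂ (arcs a) ∘ Sum.map₂ (∈-resp-↭ (↭-sym arcs↭)))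
  where
  xs↭ : xs ↭ h ∷ R
  xs↭ = Rotation⇒↭ rot
  arcs↭ : cyclicArcs xs ↭ cyclicArcs (h ∷ R)
  arcs↭ = cyclicArcs-resp-Rotation rot

record RootedTreeJoin (k : ℕ) (D : Digraph) (h : ℕ) (R : List ℕ) : Set where
  field
    tree : Tree
    components : Fin (length (TE tree)) → Digraph
    components-EHT : ∀ i → EHT k (components i)
    eulerTail : List ℕ
    isTreeJoin : IsTreeJoin tree (h ∷ R) components D
    eulerian : EulerianList tree (h ∷ eulerTail)
    tail⊆ : R ⊆ eulerTail

rootTreeJoin : ∀ {k D h R} (t : TreeJoinOf k D) → Rotation (TreeJoinOf.cycle t) (h ∷ R) → RootedTreeJoin k D h R
rootTreeJoin {D = D} t rot with rootEulerian tree (TreeJoin.partialEulerian tree cycle components D isTreeJoin) rot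
  where open TreeJoinOf t
... | M , eul , R⊆M = record
  { tree = tree
  ; components = components
  ; components-EHT = components-EHT
  ; eulerTail = M
  ; isTreeJoin = IsTreeJoin-resp-Rotation {tree} {Ds = components} {D} rot isTreeJoin
  ; eulerian = eul
  ; tail⊆ = R⊆M
  }
  where open TreeJoinOf t

rootAtTarget : ∀ {k D u v} (t : TreeJoinOf k D) → u ≢ v → (u , v) ∈ cyclicArcs (TreeJoinOf.cycle t) →
               Σ[ R ∈ List ℕ ] RootedTreeJoin k D v (R ++ [ u ])
rootAtTarget t u≢v uv∈C with ∈-cyclicArcs⁻ (TreeJoinOf.cycle t) u≢v uv∈C
... | R , rot = R , rootTreeJoin t (rotation-trans rot (rot-step rot-refl))

rootAtSource : ∀ {k D v w} (t : TreeJoinOf k D) → v ≢ w → (v , w) ∈ cyclicArcs (TreeJoinOf.cycle t) →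
               Σ[ R ∈ List ℕ ] RootedTreeJoin k D v (w ∷ R)
rootAtSource t v≢w vw∈C with ∈-cyclicArcs⁻ (TreeJoinOf.cycle t) v≢w vw∈C
... | R , rot = R , rootTreeJoin t rot

-- Gluing two trees at a common vertex

module GluedTree (T₁ T₂ : Tree) (v : ℕ) (shared : ∀ {x} → x ∈ TV T₁ → x ∈ TV T₂ → x ≡ v)
                 (v∈T₁ : v ∈ TV T₁) (v∈T₂ : v ∈ TV T₂) where

  TV⁺ : ∀ {x} → x ∈ TV T₁ ⊎ x ∈ TV T₂ → x ∈ deduplicate _≟_ (TV T₁ ++ TV T₂)
  TV⁺ (inj₁ x∈T₁) = ∈-deduplicate⁺ _≟_ (∈-++⁺ˡ x∈T₁)
  TV⁺ (inj₂ x∈T₂) = ∈-deduplicate⁺ _≟_ (∈-++⁺ʳ (TV T₁) x∈T₂)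

  TV⁻ : ∀ {x} → x ∈ deduplicate _≟_ (TV T₁ ++ TV T₂) → x ∈ TV T₁ ⊎ x ∈ TV T₂
  TV⁻ x∈T = ∈-++⁻ (TV T₁) (∈-deduplicate⁻ _≟_ (TV T₁ ++ TV T₂) x∈T)

  symArcs⁻ : ∀ {a} → a ∈ symArcs (TE T₁ ++ TE T₂) → a ∈ symArcs (TE T₁) ⊎ a ∈ symArcs (TE T₂)
  symArcs⁻ a∈T = ∈-++⁻ (symArcs (TE T₁)) (subst (_ ∈_) (symArcs-++ (TE T₁) (TE T₂)) a∈T)

  symArcs⁺ : ∀ {a} → a ∈ symArcs (TE T₁) ⊎ a ∈ symArcs (TE T₂) → a ∈ symArcs (TE T₁ ++ TE T₂)
  symArcs⁺ (inj₁ a∈T₁) = subst (_ ∈_) (sym (symArcs-++ (TE T₁) (TE T₂))) (∈-++⁺ˡ a∈T₁)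
  symArcs⁺ (inj₂ a∈T₂) = subst (_ ∈_) (sym (symArcs-++ (TE T₁) (TE T₂))) (∈-++⁺ʳ (symArcs (TE T₁)) a∈T₂)

  OneSide : List Arc → Set
  OneSide l = All (_∈ symArcs (TE T₁)) l ⊎ All (_∈ symArcs (TE T₂)) l

  private
    first-arc : ∀ {P : Arc → Set} y q z → All P (pathArcs (y ∷ q ++ [ z ])) → ∃[ t ] P (y , t)
    first-arc y [] z (p ∷ _) = z , p
    first-arc y (q₁ ∷ q) z (p ∷ _) = q₁ , p

  -- Two consecutive arcs from different trees would meet at an interior vertex, which must be v.
  avoiding-v⇒OneSide : ∀ x q z → All (_≢ v) q → All (_∈ symArcs (TE T₁ ++ TE T₂)) (pathArcs (x ∷ q ++ [ z ])) →
                       OneSide (pathArcs (x ∷ q ++ [ z ]))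
  avoiding-v⇒OneSide x [] z _ (p ∷ []) = Sum.map (_∷ []) (_∷ []) (symArcs⁻ p)
  avoiding-v⇒OneSide x (y ∷ q) z (y≢v ∷ q≢v) (p ∷ ps) with avoiding-v⇒OneSide y q z q≢v ps | symArcs⁻ p
  ... | inj₁ rest | inj₁ p₁ = inj₁ (p₁ ∷ rest)
  ... | inj₂ rest | inj₂ p₂ = inj₂ (p₂ ∷ rest)
  ... | inj₂ rest | inj₁ p₁ =
    ⊥-elim (y≢v (shared (proj₂ (symArcs-TV T₁ p₁)) (proj₁ (symArcs-TV T₂ (proj₂ (first-arc y q z rest))))))
  ... | inj₁ rest | inj₂ p₂ =
    ⊥-elim (y≢v (shared (proj₁ (symArcs-TV T₁ (proj₂ (first-arc y q z rest)))) (proj₂ (symArcs-TV T₂ p₂))))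

  -- Rotating a cycle to start at v (if it passes through v), every arc lies on one side.
  acyclic-glued : ∀ c → Unique c → 3 ≤ length c → ¬ All (_∈ symArcs (TE T₁ ++ TE T₂)) (cyclicArcs c)
  acyclic-glued [] _ ()
  acyclic-glued c@(h₀ ∷ r₀) c-unique 3≤|c| all = noCycle (rootAtV (v ∈? c))
    where
    RootedAwayFromV : Set
    RootedAwayFromV = Σ[ h ∈ ℕ ] Σ[ r ∈ List ℕ ] (Rotation c (h ∷ r) × v ∉ r)
    rootAtV : Dec (v ∈ c) → RootedAwayFromV
    rootAtV (yes v∈c) with ∈-∃++ v∈c
    ... | pre , post , c≡ = v , post ++ pre , rot , Unique[x∷xs]⇒x∉xs (Unique-resp-Rotation rot c-unique)
      where
      rot : Rotation c (v ∷ post ++ pre)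
      rot = subst (λ l → Rotation l (v ∷ post ++ pre)) (sym c≡) (++-rotation pre (v ∷ post))
    rootAtV (no v∉c) = h₀ , r₀ , rot-refl , v∉c ∘ there
    noCycle : RootedAwayFromV → ⊥
    noCycle (h , r , rot , v∉r) =
      Sum.[ acyclic T₁ (h ∷ r) hr-unique 3≤|hr| ∘ closed , acyclic T₂ (h ∷ r) hr-unique 3≤|hr| ∘ closed ]′
        (avoiding-v⇒OneSide h r h (¬Any⇒All¬ r (v∉r ∘ Any.map sym))
          (subst (All _) (cyclicArcs-pathArcs h r) (All-resp-↭ (cyclicArcs-resp-Rotation rot) all)))
      where
      hr-unique : Unique (h ∷ r)
      hr-unique = Unique-resp-Rotation rot c-unique
      3≤|hr| : 3 ≤ length (h ∷ r)
      3≤|hr| = subst (3 ≤_) (↭-length (Rotation⇒↭ rot)) 3≤|c|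
      closed : ∀ {P : Arc → Set} → All P (pathArcs (h ∷ r ++ [ h ])) → All P (cyclicArcs (h ∷ r))
      closed = subst (All _) (sym (cyclicArcs-pathArcs h r))

  private
    TE-in-V-glued : ∀ {x y} → (x , y) ∈ TE T₁ ++ TE T₂ →
                    x ∈ deduplicate _≟_ (TV T₁ ++ TV T₂) × y ∈ deduplicate _≟_ (TV T₁ ++ TV T₂)
    TE-in-V-glued e with ∈-++⁻ (TE T₁) e
    ... | inj₁ e₁ = Data.Product.map (TV⁺ ∘ inj₁) (TV⁺ ∘ inj₁) (TE-in-V T₁ e₁)
    ... | inj₂ e₂ = Data.Product.map (TV⁺ ∘ inj₂) (TV⁺ ∘ inj₂) (TE-in-V T₂ e₂)

    -- A common arc would have both endpoints equal to v.
    TE-simple-glued : Unique (symArcs (TE T₁ ++ TE T₂))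
    TE-simple-glued = subst Unique (sym (symArcs-++ (TE T₁) (TE T₂)))
                        (Unique.++⁺ (TE-simple T₁) (TE-simple T₂) no-common-arc)
      where
      no-common-arc : ∀ {a} → a ∈ symArcs (TE T₁) × a ∈ symArcs (TE T₂) → ⊥
      no-common-arc (a∈T₁ , a∈T₂)
        with shared (proj₁ (symArcs-TV T₁ a∈T₁)) (proj₁ (symArcs-TV T₂ a∈T₂))
           | shared (proj₂ (symArcs-TV T₁ a∈T₁)) (proj₂ (symArcs-TV T₂ a∈T₂))
      ... | refl | refl = symArcs-loopless T₁ a∈T₁

    Reach-to-v : ∀ {x} → x ∈ TV T₁ ⊎ x ∈ TV T₂ → Reach (TE T₁ ++ TE T₂) x v
    Reach-to-v (inj₁ x∈T₁) = Reach-mono (symArcs⁺ ∘ inj₁) (connected T₁ x∈T₁ v∈T₁)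
    Reach-to-v (inj₂ x∈T₂) = Reach-mono (symArcs⁺ ∘ inj₂) (connected T₂ x∈T₂ v∈T₂)

    Reach-from-v : ∀ {x} → x ∈ TV T₁ ⊎ x ∈ TV T₂ → Reach (TE T₁ ++ TE T₂) v x
    Reach-from-v (inj₁ x∈T₁) = Reach-mono (symArcs⁺ ∘ inj₁) (connected T₁ v∈T₁ x∈T₁)
    Reach-from-v (inj₂ x∈T₂) = Reach-mono (symArcs⁺ ∘ inj₂) (connected T₂ v∈T₂ x∈T₂)

  glued : Tree
  glued = record
    { TV = deduplicate _≟_ (TV T₁ ++ TV T₂)
    ; TE = TE T₁ ++ TE T₂
    ; TV-unique = UniqueDec.deduplicate-! _≟_ (TV T₁ ++ TV T₂)
    ; TE-in-V = TE-in-V-glued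
    ; TE-loopless = λ e → Sum.[ TE-loopless T₁ , TE-loopless T₂ ]′ (∈-++⁻ (TE T₁) e)
    ; TE-simple = TE-simple-glued
    ; connected = λ x∈T y∈T → Reach-trans (Reach-to-v (TV⁻ x∈T)) (Reach-from-v (TV⁻ y∈T))
    ; acyclic = acyclic-glued
    }

  deg-glued : ∀ x → deg glued x ≡ deg T₁ x + deg T₂ x
  deg-glued = degE-++ (TE T₁) (TE T₂)

module _ {X : Set} where

  splitIndex : ∀ (l₁ l₂ : List X) → Fin (length (l₁ ++ l₂)) → Fin (length l₁) ⊎ Fin (length l₂)
  splitIndex [] l₂ i = inj₂ i
  splitIndex (x ∷ l₁) l₂ zero = inj₁ zero
  splitIndex (x ∷ l₁) l₂ (suc i) = Sum.map₁ suc (splitIndex l₁ l₂ i)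

  indexˡ : ∀ (l₁ l₂ : List X) → Fin (length l₁) → Fin (length (l₁ ++ l₂))
  indexˡ (x ∷ l₁) l₂ zero = zero
  indexˡ (x ∷ l₁) l₂ (suc j) = suc (indexˡ l₁ l₂ j)

  indexʳ : ∀ (l₁ l₂ : List X) → Fin (length l₂) → Fin (length (l₁ ++ l₂))
  indexʳ [] l₂ j = j
  indexʳ (x ∷ l₁) l₂ j = suc (indexʳ l₁ l₂ j)

  splitIndex-indexˡ : ∀ (l₁ l₂ : List X) j → splitIndex l₁ l₂ (indexˡ l₁ l₂ j) ≡ inj₁ j
  splitIndex-indexˡ (x ∷ l₁) l₂ zero = refl
  splitIndex-indexˡ (x ∷ l₁) l₂ (suc j) = cong (Sum.map₁ suc) (splitIndex-indexˡ l₁ l₂ j)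

  splitIndex-indexʳ : ∀ (l₁ l₂ : List X) j → splitIndex l₁ l₂ (indexʳ l₁ l₂ j) ≡ inj₂ j
  splitIndex-indexʳ [] l₂ j = refl
  splitIndex-indexʳ (x ∷ l₁) l₂ j = cong (Sum.map₁ suc) (splitIndex-indexʳ l₁ l₂ j)

  lookup-splitIndexˡ : ∀ (l₁ l₂ : List X) i j → splitIndex l₁ l₂ i ≡ inj₁ j → lookup (l₁ ++ l₂) i ≡ lookup l₁ j
  lookup-splitIndexˡ (x ∷ l₁) l₂ zero zero _ = refl
  lookup-splitIndexˡ (x ∷ l₁) l₂ (suc i) j eq with splitIndex l₁ l₂ i in eq′
  lookup-splitIndexˡ (x ∷ l₁) l₂ (suc i) .(suc j′) refl | inj₁ j′ = lookup-splitIndexˡ l₁ l₂ i j′ eq′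

  lookup-splitIndexʳ : ∀ (l₁ l₂ : List X) i j → splitIndex l₁ l₂ i ≡ inj₂ j → lookup (l₁ ++ l₂) i ≡ lookup l₂ j
  lookup-splitIndexʳ [] l₂ i j refl = refl
  lookup-splitIndexʳ (x ∷ l₁) l₂ (suc i) j eq with splitIndex l₁ l₂ i in eq′
  lookup-splitIndexʳ (x ∷ l₁) l₂ (suc i) j refl | inj₂ j′ = lookup-splitIndexʳ l₁ l₂ i j eq′

  splitIndex-injective : ∀ (l₁ l₂ : List X) i i′ → splitIndex l₁ l₂ i ≡ splitIndex l₁ l₂ i′ → i ≡ i′
  splitIndex-injective [] l₂ i i′ refl = refl
  splitIndex-injective (x ∷ l₁) l₂ zero zero _ = refl
  splitIndex-injective (x ∷ l₁) l₂ zero (suc i′) eq with splitIndex l₁ l₂ i′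
  splitIndex-injective (x ∷ l₁) l₂ zero (suc i′) () | inj₁ _
  splitIndex-injective (x ∷ l₁) l₂ zero (suc i′) () | inj₂ _
  splitIndex-injective (x ∷ l₁) l₂ (suc i) zero eq with splitIndex l₁ l₂ i
  splitIndex-injective (x ∷ l₁) l₂ (suc i) zero () | inj₁ _
  splitIndex-injective (x ∷ l₁) l₂ (suc i) zero () | inj₂ _
  splitIndex-injective (x ∷ l₁) l₂ (suc i) (suc i′) eq with splitIndex l₁ l₂ i in e | splitIndex l₁ l₂ i′ in e′
  splitIndex-injective (x ∷ l₁) l₂ (suc i) (suc i′) refl | inj₁ _ | inj₁ _ =
    cong suc (splitIndex-injective l₁ l₂ i i′ (trans e (sym e′)))
  splitIndex-injective (x ∷ l₁) l₂ (suc i) (suc i′) refl | inj₂ _ | inj₂ _ =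
    cong suc (splitIndex-injective l₁ l₂ i i′ (trans e (sym e′)))

module _ {X Y : Set} (f : X → Y) where

  unmapIndex : ∀ l → Fin (length (map f l)) → Fin (length l)
  unmapIndex (x ∷ l) zero = zero
  unmapIndex (x ∷ l) (suc i) = suc (unmapIndex l i)

  mapIndex : ∀ l → Fin (length l) → Fin (length (map f l))
  mapIndex (x ∷ l) zero = zero
  mapIndex (x ∷ l) (suc j) = suc (mapIndex l j)

  unmapIndex-mapIndex : ∀ l j → unmapIndex l (mapIndex l j) ≡ j
  unmapIndex-mapIndex (x ∷ l) zero = refl
  unmapIndex-mapIndex (x ∷ l) (suc j) = cong suc (unmapIndex-mapIndex l j)

  unmapIndex-injective : ∀ l i i′ → unmapIndex l i ≡ unmapIndex l i′ → i ≡ i′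
  unmapIndex-injective (x ∷ l) zero zero _ = refl
  unmapIndex-injective (x ∷ l) (suc i) (suc i′) eq = cong suc (unmapIndex-injective l i i′ (Fin.suc-injective eq))

  lookup-map-unmapIndex : ∀ l i → lookup (map f l) i ≡ f (lookup l (unmapIndex l i))
  lookup-map-unmapIndex (x ∷ l) zero = refl
  lookup-map-unmapIndex (x ∷ l) (suc i) = lookup-map-unmapIndex l i

-- Hajós joins in which the identified vertex keeps its name

record HajosJoinAt (D₁ D₂ : Digraph) (u v w : ℕ) (D : Digraph) : Set where
  field
    shared : ∀ {x} → x ∈ V D₁ → x ∈ V D₂ → x ≡ v
    uv∈D₁ : (u , v) ∈ A D₁
    vw∈D₂ : (v , w) ∈ A D₂
    vertices : ∀ x → x ∈ V D ⇔′ (x ∈ V D₁ ⊎ x ∈ V D₂)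
    arcs : ∀ a → a ∈ A D ⇔′ ((a ∈ A D₁ × a ≢ (u , v)) ⊎ (a ∈ A D₂ × a ≢ (v , w)) ⊎ a ≡ (u , w))

_≟ᵃ_ : (a b : Arc) → Dec (a ≡ b)
_≟ᵃ_ = ≡-dec _≟_ _≟_

hajosJoinAt : ∀ D₁ D₂ u v w → (∀ {x} → x ∈ V D₁ → x ∈ V D₂ → x ≡ v) → (u , v) ∈ A D₁ → (v , w) ∈ A D₂ →
              Σ Digraph (HajosJoinAt D₁ D₂ u v w)
hajosJoinAt D₁ D₂ u v w shared uv∈D₁ vw∈D₂ = D , record
  { shared = shared ; uv∈D₁ = uv∈D₁ ; vw∈D₂ = vw∈D₂ ; vertices = vertices ; arcs = arcs }
  where
  keep₁ : List Arc
  keep₁ = filter (λ a → ¬? (a ≟ᵃ (u , v))) (A D₁)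
  keep₂ : List Arc
  keep₂ = filter (λ a → ¬? (a ≟ᵃ (v , w))) (A D₂)
  allArcs : List Arc
  allArcs = keep₁ ++ keep₂ ++ [ (u , w) ]
  vertices : ∀ x → x ∈ deduplicate _≟_ (V D₁ ++ V D₂) ⇔′ (x ∈ V D₁ ⊎ x ∈ V D₂)
  vertices x = (λ x∈D → ∈-++⁻ (V D₁) (∈-deduplicate⁻ _≟_ (V D₁ ++ V D₂) x∈D))
             , (λ x∈Dᵢ → ∈-deduplicate⁺ _≟_ (Sum.[ ∈-++⁺ˡ , ∈-++⁺ʳ (V D₁) ]′ x∈Dᵢ))
  arcs : ∀ a → a ∈ deduplicate _≟ᵃ_ allArcs ⇔′
               ((a ∈ A D₁ × a ≢ (u , v)) ⊎ (a ∈ A D₂ × a ≢ (v , w)) ⊎ a ≡ (u , w))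
  arcs a = fwd , bwd
    where
    fwd : a ∈ deduplicate _≟ᵃ_ allArcs → (a ∈ A D₁ × a ≢ (u , v)) ⊎ (a ∈ A D₂ × a ≢ (v , w)) ⊎ a ≡ (u , w)
    fwd a∈D with ∈-++⁻ keep₁ (∈-deduplicate⁻ _≟ᵃ_ allArcs a∈D)
    ... | inj₁ a∈keep₁ = inj₁ (∈-filter⁻ (λ a → ¬? (a ≟ᵃ (u , v))) a∈keep₁)
    ... | inj₂ a∈rest with ∈-++⁻ keep₂ a∈rest
    ...   | inj₁ a∈keep₂ = inj₂ (inj₁ (∈-filter⁻ (λ a → ¬? (a ≟ᵃ (v , w))) a∈keep₂))
    ...   | inj₂ (here refl) = inj₂ (inj₂ refl)
    bwd : (a ∈ A D₁ × a ≢ (u , v)) ⊎ (a ∈ A D₂ × a ≢ (v , w)) ⊎ a ≡ (u , w) → a ∈ deduplicate _≟ᵃ_ allArcs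
    bwd (inj₁ (a∈D₁ , a≢uv)) =
      ∈-deduplicate⁺ _≟ᵃ_ (∈-++⁺ˡ (∈-filter⁺ (λ a → ¬? (a ≟ᵃ (u , v))) a∈D₁ a≢uv))
    bwd (inj₂ (inj₁ (a∈D₂ , a≢vw))) =
      ∈-deduplicate⁺ _≟ᵃ_ (∈-++⁺ʳ keep₁ (∈-++⁺ˡ (∈-filter⁺ (λ a → ¬? (a ≟ᵃ (v , w))) a∈D₂ a≢vw)))
    bwd (inj₂ (inj₂ refl)) = ∈-deduplicate⁺ _≟ᵃ_ (∈-++⁺ʳ keep₁ (∈-++⁺ʳ keep₂ (here refl)))
  arc-ends : ∀ {x y} → (x , y) ∈ deduplicate _≟ᵃ_ allArcs →
             x ∈ deduplicate _≟_ (V D₁ ++ V D₂) × y ∈ deduplicate _≟_ (V D₁ ++ V D₂)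
  arc-ends xy∈D with proj₁ (arcs _) xy∈D
  ... | inj₁ (xy∈D₁ , _) =
    Data.Product.map (proj₂ (vertices _) ∘ inj₁) (proj₂ (vertices _) ∘ inj₁) (A-in-V D₁ xy∈D₁)
  ... | inj₂ (inj₁ (xy∈D₂ , _)) =
    Data.Product.map (proj₂ (vertices _) ∘ inj₂) (proj₂ (vertices _) ∘ inj₂) (A-in-V D₂ xy∈D₂)
  ... | inj₂ (inj₂ refl) = proj₂ (vertices _) (inj₁ (proj₁ (A-in-V D₁ uv∈D₁)))
                         , proj₂ (vertices _) (inj₂ (proj₂ (A-in-V D₂ vw∈D₂)))
  no-loop : ∀ {x} → (x , x) ∉ deduplicate _≟ᵃ_ allArcs
  no-loop xx∈D with proj₁ (arcs _) xx∈D
  ... | inj₁ (xx∈D₁ , _) = loopless D₁ xx∈D₁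
  ... | inj₂ (inj₁ (xx∈D₂ , _)) = loopless D₂ xx∈D₂
  ... | inj₂ (inj₂ refl) with shared (proj₁ (A-in-V D₁ uv∈D₁)) (proj₂ (A-in-V D₂ vw∈D₂))
  ...   | refl = loopless D₁ uv∈D₁
  D : Digraph
  D = record
    { V = deduplicate _≟_ (V D₁ ++ V D₂)
    ; A = deduplicate _≟ᵃ_ allArcs
    ; V-unique = UniqueDec.deduplicate-! _≟_ (V D₁ ++ V D₂)
    ; A-unique = UniqueDec.deduplicate-! _≟ᵃ_ allArcs
    ; A-in-V = arc-ends
    ; loopless = no-loop
    }

∈V-cong : ∀ {G H : Digraph} {x} → G ≡ H → x ∈ V G → x ∈ V H
∈V-cong refl x∈G = x∈G

∈A-cong : ∀ {G H : Digraph} {a} → G ≡ H → a ∈ A G → a ∈ A H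
∈A-cong refl a∈G = a∈G

Endpoint-cong : ∀ {x a b a′ b′} → a ≡ a′ → b ≡ b′ → Endpoint a b x → Endpoint a′ b′ x
Endpoint-cong refl refl e = e

Digon-cong : ∀ {G H : Digraph} {a b a′ b′} → G ≡ H → a ≡ a′ → b ≡ b′ →
             (a , b) ∈ A G × (b , a) ∈ A G → (a′ , b′) ∈ A H × (b′ , a′) ∈ A H
Digon-cong refl refl refl d = d

InDigon-cong : ∀ {c a b a′ b′} → a ≡ a′ → b ≡ b′ → InDigon a b c → InDigon a′ b′ c
InDigon-cong refl refl d = d

-- Gluing two tree joins along a Hajós join: if uv closes the cycle of D₁ and vw opens the
-- cycle of D₂, the trees are glued at v and the two cycles are spliced into one through uw.
module GlueRooted {k : ℕ} {D₁ D₂ D : Digraph} {u v w : ℕ} {R₁ R₂ : List ℕ}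
  (rooted₁ : RootedTreeJoin k D₁ v (R₁ ++ [ u ])) (rooted₂ : RootedTreeJoin k D₂ v (w ∷ R₂))
  (join : HajosJoinAt D₁ D₂ u v w D) where

  open RootedTreeJoin rooted₁ renaming (tree to T₁; components to Ds₁; components-EHT to Ds₁-EHT;
    eulerTail to M₁; isTreeJoin to tj₁; eulerian to eul₁; tail⊆ to R₁⊆M₁)
  open RootedTreeJoin rooted₂ renaming (tree to T₂; components to Ds₂; components-EHT to Ds₂-EHT;
    eulerTail to M₂; isTreeJoin to tj₂; eulerian to eul₂; tail⊆ to R₂⊆M₂)
  module J₁ = TreeJoin T₁ (v ∷ R₁ ++ [ u ]) Ds₁ D₁ tj₁
  module J₂ = TreeJoin T₂ (v ∷ w ∷ R₂) Ds₂ D₂ tj₂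
  open HajosJoinAt join renaming (vertices to join-vertices; arcs to join-arcs)

  shared-TV : ∀ {x} → x ∈ TV T₁ → x ∈ TV T₂ → x ≡ v
  shared-TV x∈T₁ x∈T₂ = shared (J₁.TV⊆V x∈T₁) (J₂.TV⊆V x∈T₂)

  v∈T₁ : v ∈ TV T₁
  v∈T₁ = J₁.xs⊆TV (here refl)

  v∈T₂ : v ∈ TV T₂
  v∈T₂ = J₂.xs⊆TV (here refl)

  open GluedTree T₁ T₂ v shared-TV v∈T₁ v∈T₂

  u∈T₁ : u ∈ TV T₁
  u∈T₁ = J₁.xs⊆TV (there (∈-++⁺ʳ R₁ (here refl)))

  w∈T₂ : w ∈ TV T₂
  w∈T₂ = J₂.xs⊆TV (there (here refl))

  u≢v : u ≢ v
  u≢v refl = loopless D₁ uv∈D₁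

  v≢w : v ≢ w
  v≢w refl = loopless D₂ vw∈D₂

  cycle : List ℕ
  cycle = v ∷ (R₁ ++ [ u ]) ++ w ∷ R₂

  E₁ : List Arc
  E₁ = TE T₁

  E₂ : List Arc
  E₂ = TE T₂

  Ds : Fin (length (TE glued)) → Digraph
  Ds i = [ Ds₁ , Ds₂ ]′ (splitIndex E₁ E₂ i)

  Ds-EHT : ∀ i → EHT k (Ds i)
  Ds-EHT i with splitIndex E₁ E₂ i
  ... | inj₁ j = Ds₁-EHT j
  ... | inj₂ j = Ds₂-EHT j

  data Origin (i : Fin (length (TE glued))) : Set where
    left  : ∀ j → splitIndex E₁ E₂ i ≡ inj₁ j → Ds i ≡ Ds₁ j → eu glued i ≡ eu T₁ j → ev glued i ≡ ev T₁ j → Origin i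
    right : ∀ j → splitIndex E₁ E₂ i ≡ inj₂ j → Ds i ≡ Ds₂ j → eu glued i ≡ eu T₂ j → ev glued i ≡ ev T₂ j → Origin i

  origin : ∀ i → Origin i
  origin i with splitIndex E₁ E₂ i in eq
  ... | inj₁ j = left j eq (cong [ Ds₁ , Ds₂ ]′ eq) (cong proj₁ (lookup-splitIndexˡ E₁ E₂ i j eq))
                                                    (cong proj₂ (lookup-splitIndexˡ E₁ E₂ i j eq))
  ... | inj₂ j = right j eq (cong [ Ds₁ , Ds₂ ]′ eq) (cong proj₁ (lookup-splitIndexʳ E₁ E₂ i j eq))
                                                     (cong proj₂ (lookup-splitIndexʳ E₁ E₂ i j eq))

  Ds-indexˡ : ∀ j → Ds (indexˡ E₁ E₂ j) ≡ Ds₁ j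
  Ds-indexˡ j = cong [ Ds₁ , Ds₂ ]′ (splitIndex-indexˡ E₁ E₂ j)

  Ds-indexʳ : ∀ j → Ds (indexʳ E₁ E₂ j) ≡ Ds₂ j
  Ds-indexʳ j = cong [ Ds₁ , Ds₂ ]′ (splitIndex-indexʳ E₁ E₂ j)

  lookup-indexˡ : ∀ j → lookup (TE glued) (indexˡ E₁ E₂ j) ≡ lookup E₁ j
  lookup-indexˡ j = lookup-splitIndexˡ E₁ E₂ _ j (splitIndex-indexˡ E₁ E₂ j)

  lookup-indexʳ : ∀ j → lookup (TE glued) (indexʳ E₁ E₂ j) ≡ lookup E₂ j
  lookup-indexʳ j = lookup-splitIndexʳ E₁ E₂ _ j (splitIndex-indexʳ E₁ E₂ j)

  cycle-unique : Unique cycle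
  cycle-unique with J₁.xs-unique | J₂.xs-unique
  ... | v∉R₁u ∷ R₁u-unique | v∉wR₂ ∷ wR₂-unique =
    All.++⁺ v∉R₁u v∉wR₂ ∷ Unique.++⁺ R₁u-unique wR₂-unique disjoint
    where
    disjoint : ∀ {y} → y ∈ R₁ ++ [ u ] × y ∈ w ∷ R₂ → ⊥
    disjoint (y∈₁ , y∈₂) with shared-TV (J₁.xs⊆TV (there y∈₁)) (J₂.xs⊆TV (there y∈₂))
    ... | refl = All.lookup v∉R₁u y∈₁ refl

  eulerList : List ℕ
  eulerList = v ∷ M₁ ++ v ∷ M₂

  eulerList-Eulerian : EulerianList glued eulerList
  eulerList-Eulerian = subst₂ _↭_ (sym splice) (sym (symArcs-++ E₁ E₂)) (Perm.++⁺ eul₁ eul₂)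
    where
    open ≡-Reasoning
    splice : cyclicArcs eulerList ≡ cyclicArcs (v ∷ M₁) ++ cyclicArcs (v ∷ M₂)
    splice = begin
      cyclicArcs (v ∷ M₁ ++ v ∷ M₂)                         ≡⟨ cyclicArcs-pathArcs v (M₁ ++ v ∷ M₂) ⟩
      pathArcs (v ∷ (M₁ ++ v ∷ M₂) ++ [ v ])                ≡⟨ cong (λ l → pathArcs (v ∷ l)) (++-assoc M₁ (v ∷ M₂) [ v ]) ⟩
      pathArcs (v ∷ M₁ ++ v ∷ M₂ ++ [ v ])                  ≡⟨ pathArcs-++ (v ∷ M₁) v (M₂ ++ [ v ]) ⟩
      pathArcs (v ∷ M₁ ++ [ v ]) ++ pathArcs (v ∷ M₂ ++ [ v ]) ≡⟨ cong₂ _++_ (cyclicArcs-pathArcs v M₁) (cyclicArcs-pathArcs v M₂) ⟨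
      cyclicArcs (v ∷ M₁) ++ cyclicArcs (v ∷ M₂)            ∎

  -- v has an edge towards u in T₁ and one towards w in T₂.
  v-not-leaf : ¬ Leaf glued v
  v-not-leaf (_ , deg≡1) with subst (_≡ 1) (deg-glued v) deg≡1
  ... | deg≡1′ with +-mono-≤ (deg-positive T₁ v∈T₁ u∈T₁ (u≢v ∘ sym)) (deg-positive T₂ v∈T₂ w∈T₂ v≢w)
  ...   | 2≤deg = contradiction (subst (2 ≤_) deg≡1′ 2≤deg) λ { (s≤s ()) }

  leaves-on-cycle : ∀ x → Leaf glued x → x ∈ cycle
  leaves-on-cycle x leaf@(x∈T , deg≡1) with x ≟ v
  ... | yes refl = ⊥-elim (v-not-leaf leaf)
  ... | no x≢v with TV⁻ x∈T
  ...   | inj₁ x∈T₁ = fromR₁ (proj₁ (proj₂ J₁.partialEulerian) x (x∈T₁ , deg₁≡1))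
    where
    deg₁≡1 : deg T₁ x ≡ 1
    deg₁≡1 = begin
      deg T₁ x               ≡⟨ +-identityʳ _ ⟨
      deg T₁ x + 0           ≡⟨ cong (deg T₁ x +_) (deg-∉ T₂ (x≢v ∘ shared-TV x∈T₁)) ⟨
      deg T₁ x + deg T₂ x    ≡⟨ deg-glued x ⟨
      deg glued x            ≡⟨ deg≡1 ⟩
      1                      ∎
      where open ≡-Reasoning
    fromR₁ : x ∈ v ∷ R₁ ++ [ u ] → x ∈ cycle
    fromR₁ (here x≡v) = ⊥-elim (x≢v x≡v)
    fromR₁ (there x∈R₁) = there (∈-++⁺ˡ x∈R₁)
  ...   | inj₂ x∈T₂ = fromR₂ (proj₁ (proj₂ J₂.partialEulerian) x (x∈T₂ , deg₂≡1))
    where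
    deg₂≡1 : deg T₂ x ≡ 1
    deg₂≡1 = begin
      deg T₂ x               ≡⟨ cong (_+ deg T₂ x) (deg-∉ T₁ (λ x∈T₁ → x≢v (shared-TV x∈T₁ x∈T₂))) ⟨
      deg T₁ x + deg T₂ x    ≡⟨ deg-glued x ⟨
      deg glued x            ≡⟨ deg≡1 ⟩
      1                      ∎
      where open ≡-Reasoning
    fromR₂ : x ∈ v ∷ w ∷ R₂ → x ∈ cycle
    fromR₂ (here x≡v) = ⊥-elim (x≢v x≡v)
    fromR₂ (there x∈R₂) = there (∈-++⁺ʳ (R₁ ++ [ u ]) x∈R₂)

  cycle-PartialEulerian : PartialEulerianList glued cycle
  cycle-PartialEulerian =
      (eulerList , eulerList-Eulerian , [] , eulerList , refl , subst (cycle ⊆_) (sym (++-identityʳ eulerList)) cycle⊆)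
    , leaves-on-cycle
    , (λ x _ _ → Unique⇒occ≤1 cycle-unique x)
    where
    cycle⊆ : cycle ⊆ eulerList
    cycle⊆ = refl ∷ ++⁺ R₁⊆M₁ (v ∷ʳ R₂⊆M₂)

  TV-glued⇒TV₁ : ∀ j {x} → x ∈ V (Ds₁ j) → x ∈ TV glued → x ∈ TV T₁
  TV-glued⇒TV₁ j x∈D x∈T with TV⁻ x∈T
  ... | inj₁ x∈T₁ = x∈T₁
  ... | inj₂ x∈T₂ with shared (J₁.Ds⊆V j x∈D) (J₂.TV⊆V x∈T₂)
  ...   | refl = v∈T₁

  TV-glued⇒TV₂ : ∀ j {x} → x ∈ V (Ds₂ j) → x ∈ TV glued → x ∈ TV T₂
  TV-glued⇒TV₂ j x∈D x∈T with TV⁻ x∈T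
  ... | inj₂ x∈T₂ = x∈T₂
  ... | inj₁ x∈T₁ with shared (J₁.TV⊆V x∈T₁) (J₂.Ds⊆V j x∈D)
  ...   | refl = v∈T₂

  tree-vertices : ∀ i x → (x ∈ V (Ds i) × x ∈ TV glued) ⇔′ Endpoint (eu glued i) (ev glued i) x
  tree-vertices i x with origin i
  ... | left j _ Ds≡ eu≡ ev≡ =
        (λ (x∈D , x∈T) → let x∈Dⱼ = ∈V-cong Ds≡ x∈D in
           Endpoint-cong (sym eu≡) (sym ev≡) (J₁.endpoint j x∈Dⱼ (TV-glued⇒TV₁ j x∈Dⱼ x∈T)))
      , (λ e → let (x∈Dⱼ , x∈T₁) = proj₂ (J₁.tree-vertices j x) (Endpoint-cong eu≡ ev≡ e) in
           ∈V-cong (sym Ds≡) x∈Dⱼ , TV⁺ (inj₁ x∈T₁))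
  ... | right j _ Ds≡ eu≡ ev≡ =
        (λ (x∈D , x∈T) → let x∈Dⱼ = ∈V-cong Ds≡ x∈D in
           Endpoint-cong (sym eu≡) (sym ev≡) (J₂.endpoint j x∈Dⱼ (TV-glued⇒TV₂ j x∈Dⱼ x∈T)))
      , (λ e → let (x∈Dⱼ , x∈T₂) = proj₂ (J₂.tree-vertices j x) (Endpoint-cong eu≡ ev≡ e) in
           ∈V-cong (sym Ds≡) x∈Dⱼ , TV⁺ (inj₂ x∈T₂))

  digons : ∀ i → (eu glued i , ev glued i) ∈ A (Ds i) × (ev glued i , eu glued i) ∈ A (Ds i)
  digons i with origin i
  ... | left j _ Ds≡ eu≡ ev≡ = Digon-cong (sym Ds≡) (sym eu≡) (sym ev≡) (J₁.digons j)
  ... | right j _ Ds≡ eu≡ ev≡ = Digon-cong (sym Ds≡) (sym eu≡) (sym ev≡) (J₂.digons j)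

  -- Components from different sides meet only in v, which lies on the tree side of the first one.
  disjoint-interiors : ∀ i i′ → i ≢ i′ → ∀ x → x ∈ V (Ds i) → x ∈ V (Ds i′) →
                       ¬ Endpoint (eu glued i) (ev glued i) x → ¬ Endpoint (eu glued i′) (ev glued i′) x → ⊥
  disjoint-interiors i i′ i≢i′ x x∈D x∈D′ ¬e ¬e′ with origin i | origin i′
  ... | left j eq Ds≡ eu≡ ev≡ | left j′ eq′ Ds≡′ eu≡′ ev≡′ =
    J₁.disjoint-interiors j j′ (λ { refl → i≢i′ (splitIndex-injective E₁ E₂ i i′ (trans eq (sym eq′))) })
      x (∈V-cong Ds≡ x∈D) (∈V-cong Ds≡′ x∈D′) (¬e ∘ Endpoint-cong (sym eu≡) (sym ev≡)) (¬e′ ∘ Endpoint-cong (sym eu≡′) (sym ev≡′))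
  ... | right j eq Ds≡ eu≡ ev≡ | right j′ eq′ Ds≡′ eu≡′ ev≡′ =
    J₂.disjoint-interiors j j′ (λ { refl → i≢i′ (splitIndex-injective E₁ E₂ i i′ (trans eq (sym eq′))) })
      x (∈V-cong Ds≡ x∈D) (∈V-cong Ds≡′ x∈D′) (¬e ∘ Endpoint-cong (sym eu≡) (sym ev≡)) (¬e′ ∘ Endpoint-cong (sym eu≡′) (sym ev≡′))
  ... | left j _ Ds≡ eu≡ ev≡ | right j′ _ Ds≡′ _ _ with shared (J₁.Ds⊆V j (∈V-cong Ds≡ x∈D)) (J₂.Ds⊆V j′ (∈V-cong Ds≡′ x∈D′))
  ...   | refl = ¬e (Endpoint-cong (sym eu≡) (sym ev≡) (J₁.endpoint j (∈V-cong Ds≡ x∈D) v∈T₁))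
  disjoint-interiors i i′ i≢i′ x x∈D x∈D′ ¬e ¬e′ | right j _ Ds≡ _ _ | left j′ _ Ds≡′ eu≡′ ev≡′
    with shared (J₁.Ds⊆V j′ (∈V-cong Ds≡′ x∈D′)) (J₂.Ds⊆V j (∈V-cong Ds≡ x∈D))
  ...   | refl = ¬e′ (Endpoint-cong (sym eu≡′) (sym ev≡′) (J₁.endpoint j′ (∈V-cong Ds≡′ x∈D′) v∈T₁))

  vertices : ∀ x → x ∈ V D ⇔′ ((∃[ i ] x ∈ V (Ds i)) ⊎ x ∈ cycle)
  vertices x = fwd , bwd
    where
    fwd : x ∈ V D → (∃[ i ] x ∈ V (Ds i)) ⊎ x ∈ cycle
    fwd x∈D with proj₁ (join-vertices x) x∈D
    ... | inj₁ x∈D₁ with proj₁ (J₁.vertices x) x∈D₁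
    ...   | inj₁ (j , x∈Dⱼ) = inj₁ (indexˡ E₁ E₂ j , ∈V-cong (sym (Ds-indexˡ j)) x∈Dⱼ)
    ...   | inj₂ (here x≡v) = inj₂ (here x≡v)
    ...   | inj₂ (there x∈R₁) = inj₂ (there (∈-++⁺ˡ x∈R₁))
    fwd x∈D | inj₂ x∈D₂ with proj₁ (J₂.vertices x) x∈D₂
    ...   | inj₁ (j , x∈Dⱼ) = inj₁ (indexʳ E₁ E₂ j , ∈V-cong (sym (Ds-indexʳ j)) x∈Dⱼ)
    ...   | inj₂ (here x≡v) = inj₂ (here x≡v)
    ...   | inj₂ (there x∈R₂) = inj₂ (there (∈-++⁺ʳ (R₁ ++ [ u ]) x∈R₂))
    bwd : (∃[ i ] x ∈ V (Ds i)) ⊎ x ∈ cycle → x ∈ V D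
    bwd (inj₁ (i , x∈Dᵢ)) with origin i
    ... | left j _ Ds≡ _ _ = proj₂ (join-vertices x) (inj₁ (J₁.Ds⊆V j (∈V-cong Ds≡ x∈Dᵢ)))
    ... | right j _ Ds≡ _ _ = proj₂ (join-vertices x) (inj₂ (J₂.Ds⊆V j (∈V-cong Ds≡ x∈Dᵢ)))
    bwd (inj₂ (here x≡v)) = proj₂ (join-vertices x) (inj₁ (J₁.xs⊆V (here x≡v)))
    bwd (inj₂ (there x∈C)) with ∈-++⁻ (R₁ ++ [ u ]) x∈C
    ... | inj₁ x∈R₁ = proj₂ (join-vertices x) (inj₁ (J₁.xs⊆V (there x∈R₁)))
    ... | inj₂ x∈R₂ = proj₂ (join-vertices x) (inj₂ (J₂.xs⊆V (there x∈R₂)))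

  path₁ : List Arc
  path₁ = pathArcs (v ∷ R₁ ++ [ u ])

  path₂ : List Arc
  path₂ = pathArcs (w ∷ R₂ ++ [ v ])

  cycle₁-arcs : cyclicArcs (v ∷ R₁ ++ [ u ]) ≡ path₁ ++ [ (u , v) ]
  cycle₁-arcs = begin
    cyclicArcs (v ∷ R₁ ++ [ u ])              ≡⟨ cyclicArcs-pathArcs v (R₁ ++ [ u ]) ⟩
    pathArcs (v ∷ (R₁ ++ [ u ]) ++ [ v ])      ≡⟨ cong (λ l → pathArcs (v ∷ l)) (++-assoc R₁ [ u ] [ v ]) ⟩
    pathArcs ((v ∷ R₁) ++ u ∷ [ v ])           ≡⟨ pathArcs-++ (v ∷ R₁) u [ v ] ⟩
    path₁ ++ [ (u , v) ]                       ∎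
    where open ≡-Reasoning

  cycle₂-arcs : cyclicArcs (v ∷ w ∷ R₂) ≡ (v , w) ∷ path₂
  cycle₂-arcs = cong ((v , w) ∷_) (cyclicGo-pathArcs v (w ∷ R₂))

  cycle-arcs : cyclicArcs cycle ≡ path₁ ++ (u , w) ∷ path₂
  cycle-arcs = begin
    cyclicArcs cycle                                   ≡⟨ cyclicArcs-pathArcs v ((R₁ ++ [ u ]) ++ w ∷ R₂) ⟩
    pathArcs (v ∷ ((R₁ ++ [ u ]) ++ w ∷ R₂) ++ [ v ])   ≡⟨ cong (λ l → pathArcs (v ∷ l)) (reassociate R₁) ⟩
    pathArcs ((v ∷ R₁) ++ u ∷ w ∷ R₂ ++ [ v ])         ≡⟨ pathArcs-++ (v ∷ R₁) u (w ∷ R₂ ++ [ v ]) ⟩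
    path₁ ++ (u , w) ∷ path₂                           ∎
    where
    open ≡-Reasoning
    reassociate : ∀ R → ((R ++ [ u ]) ++ w ∷ R₂) ++ [ v ] ≡ R ++ u ∷ w ∷ R₂ ++ [ v ]
    reassociate [] = refl
    reassociate (x ∷ R) = cong (x ∷_) (reassociate R)

  uv∉path₁ : (u , v) ∉ path₁
  uv∉path₁ = Unique-∷ʳ⇒∉ (subst Unique cycle₁-arcs (Unique-cyclicArcs J₁.xs-unique))
    where
    Unique-∷ʳ⇒∉ : ∀ {l : List Arc} {z} → Unique (l ++ [ z ]) → z ∉ l
    Unique-∷ʳ⇒∉ {y ∷ l} (y∉ ∷ _) (here refl) = All.lookup y∉ (∈-++⁺ʳ l (here refl)) refl
    Unique-∷ʳ⇒∉ {y ∷ l} (_ ∷ u) (there z∈l) = Unique-∷ʳ⇒∉ u z∈l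

  vw∉path₂ : (v , w) ∉ path₂
  vw∉path₂ = Unique[x∷xs]⇒x∉xs (subst Unique cycle₂-arcs (Unique-cyclicArcs J₂.xs-unique))

  ∈cycle : ∀ {a} → a ∈ path₁ ⊎ a ≡ (u , w) ⊎ a ∈ path₂ → a ∈ cyclicArcs cycle
  ∈cycle (inj₁ a∈₁) = subst (_ ∈_) (sym cycle-arcs) (∈-++⁺ˡ a∈₁)
  ∈cycle (inj₂ (inj₁ refl)) = subst (_ ∈_) (sym cycle-arcs) (∈-++⁺ʳ path₁ (here refl))
  ∈cycle (inj₂ (inj₂ a∈₂)) = subst (_ ∈_) (sym cycle-arcs) (∈-++⁺ʳ path₁ (there a∈₂))

  arcs : ∀ a → a ∈ A D ⇔′ ((∃[ i ] (a ∈ A (Ds i) × ¬ InDigon (eu glued i) (ev glued i) a)) ⊎ a ∈ cyclicArcs cycle)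
  arcs a = fwd , bwd
    where
    fwd : a ∈ A D → (∃[ i ] (a ∈ A (Ds i) × ¬ InDigon (eu glued i) (ev glued i) a)) ⊎ a ∈ cyclicArcs cycle
    fwd a∈D with proj₁ (join-arcs a) a∈D
    ... | inj₁ (a∈D₁ , a≢uv) with proj₁ (J₁.arcs a) a∈D₁
    ...   | inj₁ (j , a∈Dⱼ , ¬d) = inj₁ (indexˡ E₁ E₂ j , ∈A-cong (sym (Ds-indexˡ j)) a∈Dⱼ ,
                                          ¬d ∘ InDigon-cong (cong proj₁ (lookup-indexˡ j)) (cong proj₂ (lookup-indexˡ j)))
    ...   | inj₂ a∈C₁ with ∈-++⁻ path₁ (subst (a ∈_) cycle₁-arcs a∈C₁)
    ...     | inj₁ a∈₁ = inj₂ (∈cycle (inj₁ a∈₁))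
    ...     | inj₂ (here a≡uv) = ⊥-elim (a≢uv a≡uv)
    fwd a∈D | inj₂ (inj₁ (a∈D₂ , a≢vw)) with proj₁ (J₂.arcs a) a∈D₂
    ...   | inj₁ (j , a∈Dⱼ , ¬d) = inj₁ (indexʳ E₁ E₂ j , ∈A-cong (sym (Ds-indexʳ j)) a∈Dⱼ ,
                                          ¬d ∘ InDigon-cong (cong proj₁ (lookup-indexʳ j)) (cong proj₂ (lookup-indexʳ j)))
    ...   | inj₂ a∈C₂ with subst (a ∈_) cycle₂-arcs a∈C₂
    ...     | here a≡vw = ⊥-elim (a≢vw a≡vw)
    ...     | there a∈₂ = inj₂ (∈cycle (inj₂ (inj₂ a∈₂)))
    fwd a∈D | inj₂ (inj₂ a≡uw) = inj₂ (∈cycle (inj₂ (inj₁ a≡uw)))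
    bwd : (∃[ i ] (a ∈ A (Ds i) × ¬ InDigon (eu glued i) (ev glued i) a)) ⊎ a ∈ cyclicArcs cycle → a ∈ A D
    bwd (inj₁ (i , a∈Dᵢ , ¬d)) with origin i
    ... | left j _ Ds≡ eu≡ ev≡ =
      proj₂ (join-arcs a) (inj₁ (proj₂ (J₁.arcs a) (inj₁ (j , a∈Dⱼ , ¬d′)) ,
                                 λ { refl → ¬d′ (J₁.arc-between-tree-vertices j a∈Dⱼ u∈T₁ v∈T₁ u≢v) }))
      where
      a∈Dⱼ : a ∈ A (Ds₁ j)
      a∈Dⱼ = ∈A-cong Ds≡ a∈Dᵢ
      ¬d′ : ¬ InDigon (eu T₁ j) (ev T₁ j) a
      ¬d′ = ¬d ∘ InDigon-cong (sym eu≡) (sym ev≡)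
    ... | right j _ Ds≡ eu≡ ev≡ =
      proj₂ (join-arcs a) (inj₂ (inj₁ (proj₂ (J₂.arcs a) (inj₁ (j , a∈Dⱼ , ¬d′)) ,
                                       λ { refl → ¬d′ (J₂.arc-between-tree-vertices j a∈Dⱼ v∈T₂ w∈T₂ v≢w) })))
      where
      a∈Dⱼ : a ∈ A (Ds₂ j)
      a∈Dⱼ = ∈A-cong Ds≡ a∈Dᵢ
      ¬d′ : ¬ InDigon (eu T₂ j) (ev T₂ j) a
      ¬d′ = ¬d ∘ InDigon-cong (sym eu≡) (sym ev≡)
    bwd (inj₂ a∈C) with ∈-++⁻ path₁ (subst (a ∈_) cycle-arcs a∈C)
    ... | inj₁ a∈₁ = proj₂ (join-arcs a) (inj₁ (proj₂ (J₁.arcs a) (inj₂ (subst (a ∈_) (sym cycle₁-arcs) (∈-++⁺ˡ a∈₁))) ,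
                                               λ { refl → uv∉path₁ a∈₁ }))
    ... | inj₂ (here a≡uw) = proj₂ (join-arcs a) (inj₂ (inj₂ a≡uw))
    ... | inj₂ (there a∈₂) = proj₂ (join-arcs a) (inj₂ (inj₁ (proj₂ (J₂.arcs a) (inj₂ (subst (a ∈_) (sym cycle₂-arcs) (there a∈₂))) ,
                                                              λ { refl → vw∉path₂ a∈₂ })))

  glued-EHT : EHT k D
  glued-EHT = treeJoin glued cycle Ds D Ds-EHT
    ( subst (1 ≤_) (sym (length-++ E₁)) (≤-trans J₁.nonempty (m≤m+n _ _))
    , cycle-PartialEulerian , tree-vertices , digons , disjoint-interiors , vertices , arcs )

-- If an arc e of the component Dᵢ is off its digon, any modification of D at e that adds a
-- digraph X meeting D only in a vertex of Dᵢ can be carried out inside Dᵢ.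
module ReplaceComponent {k : ℕ} {D₀ : Digraph} (T : Tree) (xs : List ℕ) (Ds : Fin (length (TE T)) → Digraph)
  (Ds-EHT : ∀ j → EHT k (Ds j)) (tj : IsTreeJoin T xs Ds D₀) (i : Fin (length (TE T)))
  {e : Arc} (e∈Dᵢ : e ∈ A (Ds i)) (e-off-digon : ¬ InDigon (eu T i) (ev T i) e)
  (X : Digraph) (Y : Arc → Set) (v : ℕ)
  (X-shared : ∀ {x} → x ∈ V X → x ∈ V D₀ → x ≡ v) (v∈Dᵢ : v ∈ V (Ds i))
  (Y-off-digon : ∀ {a} → Y a → ¬ InDigon (eu T i) (ev T i) a)
  (Dᵢ′ : Digraph) (Dᵢ′-EHT : EHT k Dᵢ′)
  (Dᵢ′-vertices : ∀ x → x ∈ V Dᵢ′ ⇔′ (x ∈ V (Ds i) ⊎ x ∈ V X))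
  (Dᵢ′-arcs : ∀ a → a ∈ A Dᵢ′ ⇔′ ((a ∈ A (Ds i) × a ≢ e) ⊎ Y a))
  (D : Digraph)
  (D-vertices : ∀ x → x ∈ V D ⇔′ (x ∈ V D₀ ⊎ x ∈ V X))
  (D-arcs : ∀ a → a ∈ A D ⇔′ ((a ∈ A D₀ × a ≢ e) ⊎ Y a)) where

  open TreeJoin T xs Ds D₀ tj

  select : ∀ j → Dec (j ≡ i) → Digraph
  select j (yes _) = Dᵢ′
  select j (no _) = Ds j

  Ds′ : Fin (length (TE T)) → Digraph
  Ds′ j = select j (j Fin.≟ i)

  data Replaced (j : Fin (length (TE T))) : Set where
    same : j ≡ i → Ds′ j ≡ Dᵢ′ → Replaced j
    other : j ≢ i → Ds′ j ≡ Ds j → Replaced j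

  replaced : ∀ j → Replaced j
  replaced j with j Fin.≟ i in eq
  ... | yes j≡i = same j≡i (cong (select j) eq)
  ... | no j≢i = other j≢i (cong (select j) eq)

  Ds′-i : Ds′ i ≡ Dᵢ′
  Ds′-i with replaced i
  ... | same _ eq = eq
  ... | other i≢i _ = ⊥-elim (i≢i refl)

  Ds′-EHT : ∀ j → EHT k (Ds′ j)
  Ds′-EHT j with replaced j
  ... | same _ eq = subst (EHT k) (sym eq) Dᵢ′-EHT
  ... | other _ eq = subst (EHT k) (sym eq) (Ds-EHT j)

  e-proper : proj₁ e ≢ proj₂ e
  e-proper eq = loopless (Ds i) (subst (λ z → (proj₁ e , z) ∈ A (Ds i)) (sym eq) e∈Dᵢ)

  tree-vertices′ : ∀ j x → (x ∈ V (Ds′ j) × x ∈ TV T) ⇔′ Endpoint (eu T j) (ev T j) x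
  tree-vertices′ j x with replaced j
  ... | other _ eq = (λ (x∈D , x∈T) → proj₁ (tree-vertices j x) (∈V-cong eq x∈D , x∈T))
                   , (λ ep → let (x∈D , x∈T) = proj₂ (tree-vertices j x) ep in ∈V-cong (sym eq) x∈D , x∈T)
  ... | same refl eq = fwd , bwd
    where
    fwd : x ∈ V (Ds′ i) × x ∈ TV T → Endpoint (eu T i) (ev T i) x
    fwd (x∈D , x∈T) with proj₁ (Dᵢ′-vertices x) (∈V-cong eq x∈D)
    ... | inj₁ x∈Dᵢ = endpoint i x∈Dᵢ x∈T
    ... | inj₂ x∈X with X-shared x∈X (TV⊆V x∈T)
    ...   | refl = endpoint i v∈Dᵢ x∈T
    bwd : Endpoint (eu T i) (ev T i) x → x ∈ V (Ds′ i) × x ∈ TV T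
    bwd ep = let (x∈Dᵢ , x∈T) = proj₂ (tree-vertices i x) ep in
             ∈V-cong (sym eq) (proj₂ (Dᵢ′-vertices x) (inj₁ x∈Dᵢ)) , x∈T

  digons′ : ∀ j → (eu T j , ev T j) ∈ A (Ds′ j) × (ev T j , eu T j) ∈ A (Ds′ j)
  digons′ j with replaced j
  ... | other _ eq = Digon-cong (sym eq) refl refl (digons j)
  ... | same refl eq =
        ∈A-cong (sym eq) (proj₂ (Dᵢ′-arcs _) (inj₁ (proj₁ (digons i) , λ uv≡e → e-off-digon (inj₁ (sym uv≡e)))))
      , ∈A-cong (sym eq) (proj₂ (Dᵢ′-arcs _) (inj₁ (proj₂ (digons i) , λ vu≡e → e-off-digon (inj₂ (sym vu≡e)))))

  -- A vertex of Dᵢ′ outside Dᵢ comes from X, hence is v ∈ V(Dᵢ) if it also lies in another component.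
  disjoint-interiors′ : ∀ j j′ → j ≢ j′ → ∀ x → x ∈ V (Ds′ j) → x ∈ V (Ds′ j′) →
                        ¬ Endpoint (eu T j) (ev T j) x → ¬ Endpoint (eu T j′) (ev T j′) x → ⊥
  disjoint-interiors′ j j′ j≢j′ x x∈D x∈D′ ¬e ¬e′ with replaced j | replaced j′
  ... | other _ eq | other _ eq′ = disjoint-interiors j j′ j≢j′ x (∈V-cong eq x∈D) (∈V-cong eq′ x∈D′) ¬e ¬e′
  ... | same refl _ | same refl _ = j≢j′ refl
  ... | same refl eq | other _ eq′ with proj₁ (Dᵢ′-vertices x) (∈V-cong eq x∈D)
  ...   | inj₁ x∈Dᵢ = disjoint-interiors i j′ j≢j′ x x∈Dᵢ (∈V-cong eq′ x∈D′) ¬e ¬e′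
  ...   | inj₂ x∈X with X-shared x∈X (Ds⊆V j′ (∈V-cong eq′ x∈D′))
  ...     | refl = disjoint-interiors i j′ j≢j′ x v∈Dᵢ (∈V-cong eq′ x∈D′) ¬e ¬e′
  disjoint-interiors′ j j′ j≢j′ x x∈D x∈D′ ¬e ¬e′ | other _ eq | same refl eq′ with proj₁ (Dᵢ′-vertices x) (∈V-cong eq′ x∈D′)
  ...   | inj₁ x∈Dᵢ = disjoint-interiors j i j≢j′ x (∈V-cong eq x∈D) x∈Dᵢ ¬e ¬e′
  ...   | inj₂ x∈X with X-shared x∈X (Ds⊆V j (∈V-cong eq x∈D))
  ...     | refl = disjoint-interiors j i j≢j′ x (∈V-cong eq x∈D) v∈Dᵢ ¬e ¬e′

  vertices′ : ∀ x → x ∈ V D ⇔′ ((∃[ j ] x ∈ V (Ds′ j)) ⊎ x ∈ xs)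
  vertices′ x = fwd , bwd
    where
    fwd : x ∈ V D → (∃[ j ] x ∈ V (Ds′ j)) ⊎ x ∈ xs
    fwd x∈D with proj₁ (D-vertices x) x∈D
    ... | inj₂ x∈X = inj₁ (i , ∈V-cong (sym Ds′-i) (proj₂ (Dᵢ′-vertices x) (inj₂ x∈X)))
    ... | inj₁ x∈D₀ with proj₁ (vertices x) x∈D₀
    ...   | inj₂ x∈xs = inj₂ x∈xs
    ...   | inj₁ (j , x∈Dⱼ) with replaced j
    ...     | same refl eq = inj₁ (i , ∈V-cong (sym eq) (proj₂ (Dᵢ′-vertices x) (inj₁ x∈Dⱼ)))
    ...     | other _ eq = inj₁ (j , ∈V-cong (sym eq) x∈Dⱼ)
    bwd : (∃[ j ] x ∈ V (Ds′ j)) ⊎ x ∈ xs → x ∈ V D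
    bwd (inj₂ x∈xs) = proj₂ (D-vertices x) (inj₁ (xs⊆V x∈xs))
    bwd (inj₁ (j , x∈D)) with replaced j
    ... | other _ eq = proj₂ (D-vertices x) (inj₁ (Ds⊆V j (∈V-cong eq x∈D)))
    ... | same refl eq with proj₁ (Dᵢ′-vertices x) (∈V-cong eq x∈D)
    ...   | inj₁ x∈Dᵢ = proj₂ (D-vertices x) (inj₁ (Ds⊆V i x∈Dᵢ))
    ...   | inj₂ x∈X = proj₂ (D-vertices x) (inj₂ x∈X)

  arcs′ : ∀ a → a ∈ A D ⇔′ ((∃[ j ] (a ∈ A (Ds′ j) × ¬ InDigon (eu T j) (ev T j) a)) ⊎ a ∈ cyclicArcs xs)
  arcs′ a = fwd , bwd
    where
    fwd : a ∈ A D → (∃[ j ] (a ∈ A (Ds′ j) × ¬ InDigon (eu T j) (ev T j) a)) ⊎ a ∈ cyclicArcs xs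
    fwd a∈D with proj₁ (D-arcs a) a∈D
    ... | inj₂ y = inj₁ (i , ∈A-cong (sym Ds′-i) (proj₂ (Dᵢ′-arcs a) (inj₂ y)) , Y-off-digon y)
    ... | inj₁ (a∈D₀ , a≢e) with proj₁ (arcs a) a∈D₀
    ...   | inj₂ a∈C = inj₂ a∈C
    ...   | inj₁ (j , a∈Dⱼ , ¬d) with replaced j
    ...     | same refl eq = inj₁ (i , ∈A-cong (sym eq) (proj₂ (Dᵢ′-arcs a) (inj₁ (a∈Dⱼ , a≢e))) , ¬d)
    ...     | other _ eq = inj₁ (j , ∈A-cong (sym eq) a∈Dⱼ , ¬d)
    bwd : (∃[ j ] (a ∈ A (Ds′ j) × ¬ InDigon (eu T j) (ev T j) a)) ⊎ a ∈ cyclicArcs xs → a ∈ A D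
    bwd (inj₁ (j , a∈D , ¬d)) with replaced j
    ... | same refl eq with proj₁ (Dᵢ′-arcs a) (∈A-cong eq a∈D)
    ...   | inj₁ (a∈Dᵢ , a≢e) = proj₂ (D-arcs a) (inj₁ (proj₂ (arcs a) (inj₁ (i , a∈Dᵢ , ¬d)) , a≢e))
    ...   | inj₂ y = proj₂ (D-arcs a) (inj₂ y)
    bwd (inj₁ (j , a∈D , ¬d)) | other j≢i eq =
      proj₂ (D-arcs a) (inj₁ (proj₂ (arcs a) (inj₁ (j , ∈A-cong eq a∈D , ¬d)) , a≢e))
      where
      -- e lies in Dᵢ and Dⱼ, so both its ends are endpoints of edge j.
      a≢e : a ≢ e
      a≢e refl = ¬d (endpoints⇒InDigon e-proper
        (shared-endpoint i j (j≢i ∘ sym) (proj₁ (A-in-V (Ds i) e∈Dᵢ)) (proj₁ (A-in-V (Ds j) (∈A-cong eq a∈D))))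
        (shared-endpoint i j (j≢i ∘ sym) (proj₂ (A-in-V (Ds i) e∈Dᵢ)) (proj₂ (A-in-V (Ds j) (∈A-cong eq a∈D)))))
    bwd (inj₂ a∈C) = proj₂ (D-arcs a) (inj₁ (proj₂ (arcs a) (inj₂ a∈C) , a≢e))
      where
      -- e would join two cycle vertices, which are tree vertices, hence lie on the digon of edge i.
      a≢e : a ≢ e
      a≢e refl with ∈-cyclicArcs⇒∈ xs e-proper a∈C
      ... | e₁∈xs , e₂∈xs = e-off-digon (endpoints⇒InDigon e-proper
        (endpoint i (proj₁ (A-in-V (Ds i) e∈Dᵢ)) (xs⊆TV e₁∈xs))
        (endpoint i (proj₂ (A-in-V (Ds i) e∈Dᵢ)) (xs⊆TV e₂∈xs)))

  replaced-EHT : EHT k D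
  replaced-EHT = treeJoin T xs Ds′ D Ds′-EHT
    (nonempty , partialEulerian , tree-vertices′ , digons′ , disjoint-interiors′ , vertices′ , arcs′)

-- Renaming vertices by an involution

module Renaming (s : ℕ → ℕ) (s-involutive : ∀ x → s (s x) ≡ x) where

  renameArc : Arc → Arc
  renameArc (x , y) = s x , s y

  renameArc-involutive : ∀ a → renameArc (renameArc a) ≡ a
  renameArc-involutive (x , y) = cong₂ _,_ (s-involutive x) (s-involutive y)

  s-injective : ∀ {x y} → s x ≡ s y → x ≡ y
  s-injective {x} {y} eq = trans (sym (s-involutive x)) (trans (cong s eq) (s-involutive y))

  renameArc-injective : ∀ {a b} → renameArc a ≡ renameArc b → a ≡ b
  renameArc-injective {a} {b} eq =
    trans (sym (renameArc-involutive a)) (trans (cong renameArc eq) (renameArc-involutive b))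

  s-moveˡ : ∀ {x y} → x ≡ s y → s x ≡ y
  s-moveˡ {x} {y} eq = trans (cong s eq) (s-involutive y)

  s-moveʳ : ∀ {x y} → s x ≡ y → x ≡ s y
  s-moveʳ {x} {y} eq = trans (sym (s-involutive x)) (cong s eq)

  ∈-rename⁻ : ∀ {x l} → x ∈ map s l → s x ∈ l
  ∈-rename⁻ x∈l with ∈-map⁻ s x∈l
  ... | y , y∈l , refl = subst (_∈ _) (sym (s-involutive y)) y∈l

  ∈-rename⁺ : ∀ {x l} → s x ∈ l → x ∈ map s l
  ∈-rename⁺ {x} sx∈l = subst (_∈ _) (s-involutive x) (∈-map⁺ s sx∈l)

  ∈-renameArc⁻ : ∀ {a l} → a ∈ map renameArc l → renameArc a ∈ l
  ∈-renameArc⁻ a∈l with ∈-map⁻ renameArc a∈l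
  ... | b , b∈l , refl = subst (_∈ _) (sym (renameArc-involutive b)) b∈l

  ∈-renameArc⁺ : ∀ {a l} → renameArc a ∈ l → a ∈ map renameArc l
  ∈-renameArc⁺ {a} ra∈l = subst (_∈ _) (renameArc-involutive a) (∈-map⁺ renameArc ra∈l)

  renameDigraph : Digraph → Digraph
  renameDigraph D = record
    { V = map s (V D)
    ; A = map renameArc (A D)
    ; V-unique = Unique.map⁺ s-injective (V-unique D)
    ; A-unique = Unique.map⁺ renameArc-injective (A-unique D)
    ; A-in-V = λ a∈D → Data.Product.map ∈-rename⁺ ∈-rename⁺ (A-in-V D (∈-renameArc⁻ a∈D))
    ; loopless = λ xx∈D → loopless D (∈-renameArc⁻ xx∈D)
    }

  symArcs-rename : ∀ E → symArcs (map renameArc E) ≡ map renameArc (symArcs E)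
  symArcs-rename [] = refl
  symArcs-rename ((a , b) ∷ E) = cong (λ l → (s a , s b) ∷ (s b , s a) ∷ l) (symArcs-rename E)

  cyclicGo-rename : ∀ f l → cyclicGo (s f) (map s l) ≡ map renameArc (cyclicGo f l)
  cyclicGo-rename f [] = refl
  cyclicGo-rename f (x ∷ []) = refl
  cyclicGo-rename f (x ∷ y ∷ l) = cong ((s x , s y) ∷_) (cyclicGo-rename f (y ∷ l))

  cyclicArcs-rename : ∀ l → cyclicArcs (map s l) ≡ map renameArc (cyclicArcs l)
  cyclicArcs-rename [] = refl
  cyclicArcs-rename (x ∷ l) = cyclicGo-rename x (x ∷ l)

  Reach-rename : ∀ {E a b} → Reach E a b → Reach (map renameArc E) (s a) (s b)
  Reach-rename here = here
  Reach-rename {E} (step p r) = step (subst (_ ∈_) (sym (symArcs-rename E)) (∈-map⁺ renameArc p)) (Reach-rename r)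

  renameTree : Tree → Tree
  renameTree T = record
    { TV = map s (TV T)
    ; TE = map renameArc (TE T)
    ; TV-unique = Unique.map⁺ s-injective (TV-unique T)
    ; TE-in-V = λ e∈T → Data.Product.map ∈-rename⁺ ∈-rename⁺ (TE-in-V T (∈-renameArc⁻ e∈T))
    ; TE-loopless = λ xx∈T → TE-loopless T (∈-renameArc⁻ xx∈T)
    ; TE-simple = subst Unique (sym (symArcs-rename (TE T))) (Unique.map⁺ renameArc-injective (TE-simple T))
    ; connected = λ {x} {y} x∈T y∈T →
        subst₂ (Reach _) (s-involutive x) (s-involutive y) (Reach-rename (connected T (∈-rename⁻ x∈T) (∈-rename⁻ y∈T)))
    ; acyclic = acyclic-renamed
    }
    where
    acyclic-renamed : ∀ c → Unique c → 3 ≤ length c → ¬ All (_∈ symArcs (map renameArc (TE T))) (cyclicArcs c)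
    acyclic-renamed c c-unique 3≤|c| all =
      acyclic T (map s c) (Unique.map⁺ s-injective c-unique) (subst (3 ≤_) (sym (length-map s c)) 3≤|c|)
        (All.tabulate λ {a} a∈C → subst (_∈ symArcs (TE T)) (renameArc-involutive a)
          (∈-renameArc⁻ (subst (_ ∈_) (symArcs-rename (TE T))
            (All.lookup all (∈-renameArc⁻ (subst (a ∈_) (cyclicArcs-rename c) a∈C))))))

  Incident-rename : ∀ {x a b} → Incident (s x) (a , b) → Incident x (s a , s b)
  Incident-rename = Sum.map s-moveˡ s-moveˡ

  degE-rename : ∀ E x → degE (map renameArc E) x ≡ degE E (s x)
  degE-rename [] x = refl
  degE-rename ((a , b) ∷ E) x with incident? (s x) (a , b)
  ... | yes i = begin
    degE ((s a , s b) ∷ map renameArc E) x ≡⟨ degE-incident (map renameArc E) (Incident-rename i) ⟩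
    suc (degE (map renameArc E) x)         ≡⟨ cong suc (degE-rename E x) ⟩
    suc (degE E (s x))                     ≡⟨ degE-incident E i ⟨
    degE ((a , b) ∷ E) (s x)               ∎
    where open ≡-Reasoning
  ... | no ¬i = begin
    degE ((s a , s b) ∷ map renameArc E) x ≡⟨ degE-nonincident (map renameArc E) (¬i ∘ Sum.map s-moveʳ s-moveʳ) ⟩
    degE (map renameArc E) x               ≡⟨ degE-rename E x ⟩
    degE E (s x)                           ≡⟨ degE-nonincident E ¬i ⟨
    degE ((a , b) ∷ E) (s x)               ∎
    where open ≡-Reasoning

  IsSymOf-rename : ∀ {m adj D} → IsSymOf m adj D → IsSymOf m adj (renameDigraph D)
  IsSymOf-rename {D = D} (f , f-injective , vertex , adjacent) =
      s ∘ f
    , (λ i j eq → f-injective i j (s-injective eq))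
    , (λ x → (λ x∈D → Data.Product.map₂ s-moveʳ (proj₁ (vertex (s x)) (∈-rename⁻ x∈D)))
           , (λ (i , x≡) → ∈-rename⁺ (proj₂ (vertex (s x)) (i , s-moveˡ x≡))))
    , (λ i j → (λ fij∈D → proj₁ (adjacent i j)
                  (subst₂ (λ p q → (p , q) ∈ A D) (s-involutive (f i)) (s-involutive (f j)) (∈-renameArc⁻ fij∈D)))
             , (λ adj-ij → ∈-map⁺ renameArc (proj₂ (adjacent i j) adj-ij)))

  InDigon-rename⁻ : ∀ {p q a} → InDigon (s p) (s q) a → InDigon p q (renameArc a)
  InDigon-rename⁻ {p} {q} (inj₁ refl) = inj₁ (cong₂ _,_ (s-involutive p) (s-involutive q))
  InDigon-rename⁻ {p} {q} (inj₂ refl) = inj₂ (cong₂ _,_ (s-involutive q) (s-involutive p))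

  InDigon-rename⁺ : ∀ {p q a} → InDigon p q (renameArc a) → InDigon (s p) (s q) a
  InDigon-rename⁺ {a = a} = Sum.map (λ eq → trans (sym (renameArc-involutive a)) (cong renameArc eq))
                                    (λ eq → trans (sym (renameArc-involutive a)) (cong renameArc eq))

  Endpoint-rename⁻ : ∀ {x p q} → Endpoint (s p) (s q) x → Endpoint p q (s x)
  Endpoint-rename⁻ = Sum.map s-moveˡ s-moveˡ

  Endpoint-rename⁺ : ∀ {x p q} → Endpoint p q (s x) → Endpoint (s p) (s q) x
  Endpoint-rename⁺ = Sum.map s-moveʳ s-moveʳ

  module RenamedTreeJoin (T : Tree) (xs : List ℕ) (Ds : Fin (length (TE T)) → Digraph) (D : Digraph)
                         (tj : IsTreeJoin T xs Ds D) where

    open TreeJoin T xs Ds D tj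

    T′ : Tree
    T′ = renameTree T

    original : Fin (length (TE T′)) → Fin (length (TE T))
    original = unmapIndex renameArc (TE T)

    renamed : Fin (length (TE T)) → Fin (length (TE T′))
    renamed = mapIndex renameArc (TE T)

    Ds′ : Fin (length (TE T′)) → Digraph
    Ds′ i = renameDigraph (Ds (original i))

    eu′ : ∀ i → eu T′ i ≡ s (eu T (original i))
    eu′ i = cong proj₁ (lookup-map-unmapIndex renameArc (TE T) i)

    ev′ : ∀ i → ev T′ i ≡ s (ev T (original i))
    ev′ i = cong proj₂ (lookup-map-unmapIndex renameArc (TE T) i)

    Endpoint⁻ : ∀ i {x} → Endpoint (eu T′ i) (ev T′ i) x → Endpoint (eu T (original i)) (ev T (original i)) (s x)
    Endpoint⁻ i = Endpoint-rename⁻ ∘ Endpoint-cong (eu′ i) (ev′ i)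

    Endpoint⁺ : ∀ i {x} → Endpoint (eu T (original i)) (ev T (original i)) (s x) → Endpoint (eu T′ i) (ev T′ i) x
    Endpoint⁺ i = Endpoint-cong (sym (eu′ i)) (sym (ev′ i)) ∘ Endpoint-rename⁺

    InDigon⁻ : ∀ i {a} → InDigon (eu T′ i) (ev T′ i) a → InDigon (eu T (original i)) (ev T (original i)) (renameArc a)
    InDigon⁻ i = InDigon-rename⁻ ∘ InDigon-cong (eu′ i) (ev′ i)

    InDigon⁺ : ∀ i {a} → InDigon (eu T (original i)) (ev T (original i)) (renameArc a) → InDigon (eu T′ i) (ev T′ i) a
    InDigon⁺ i = InDigon-cong (sym (eu′ i)) (sym (ev′ i)) ∘ InDigon-rename⁺

    partialEulerian′ : PartialEulerianList T′ (map s xs)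
    partialEulerian′ with partialEulerian
    ... | (L , eul , P , Q , L≡ , xs⊆) , leaves , _ =
          (map s L , eul′ , map s P , map s Q , trans (cong (map s) L≡) (map-++ s P Q)
            , subst (map s xs ⊆_) (map-++ s Q P) (Sublist.map⁺ s xs⊆))
        , (λ x (x∈T′ , deg≡1) → ∈-rename⁺ (leaves (s x) (∈-rename⁻ x∈T′ , trans (sym (degE-rename (TE T) x)) deg≡1)))
        , (λ x _ _ → Unique⇒occ≤1 (Unique.map⁺ s-injective xs-unique) x)
      where
      eul′ : EulerianList T′ (map s L)
      eul′ = subst₂ _↭_ (sym (cyclicArcs-rename L)) (sym (symArcs-rename (TE T))) (map⁺ renameArc eul)

    tree-vertices′ : ∀ i x → (x ∈ V (Ds′ i) × x ∈ TV T′) ⇔′ Endpoint (eu T′ i) (ev T′ i) x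
    tree-vertices′ i x =
        (λ (x∈D , x∈T) → Endpoint⁺ i (endpoint (original i) (∈-rename⁻ x∈D) (∈-rename⁻ x∈T)))
      , (λ ep → Data.Product.map ∈-rename⁺ ∈-rename⁺ (proj₂ (tree-vertices (original i) (s x)) (Endpoint⁻ i ep)))

    digons′ : ∀ i → (eu T′ i , ev T′ i) ∈ A (Ds′ i) × (ev T′ i , eu T′ i) ∈ A (Ds′ i)
    digons′ i = Digon-cong {G = Ds′ i} refl (sym (eu′ i)) (sym (ev′ i))
                  (Data.Product.map (∈-map⁺ renameArc) (∈-map⁺ renameArc) (digons (original i)))

    disjoint-interiors′ : ∀ i i′ → i ≢ i′ → ∀ x → x ∈ V (Ds′ i) → x ∈ V (Ds′ i′) →
                          ¬ Endpoint (eu T′ i) (ev T′ i) x → ¬ Endpoint (eu T′ i′) (ev T′ i′) x → ⊥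
    disjoint-interiors′ i i′ i≢i′ x x∈D x∈D′ ¬e ¬e′ =
      disjoint-interiors (original i) (original i′) (i≢i′ ∘ unmapIndex-injective renameArc (TE T) i i′)
        (s x) (∈-rename⁻ x∈D) (∈-rename⁻ x∈D′) (¬e ∘ Endpoint⁺ i) (¬e′ ∘ Endpoint⁺ i′)

    vertices′ : ∀ x → x ∈ V (renameDigraph D) ⇔′ ((∃[ i ] x ∈ V (Ds′ i)) ⊎ x ∈ map s xs)
    vertices′ x = fwd , bwd
      where
      fwd : x ∈ V (renameDigraph D) → (∃[ i ] x ∈ V (Ds′ i)) ⊎ x ∈ map s xs
      fwd x∈D with proj₁ (vertices (s x)) (∈-rename⁻ x∈D)
      ... | inj₁ (j , sx∈Dⱼ) = inj₁ (renamed j , ∈-rename⁺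
              (subst (λ j′ → s x ∈ V (Ds j′)) (sym (unmapIndex-mapIndex renameArc (TE T) j)) sx∈Dⱼ))
      ... | inj₂ sx∈xs = inj₂ (∈-rename⁺ sx∈xs)
      bwd : (∃[ i ] x ∈ V (Ds′ i)) ⊎ x ∈ map s xs → x ∈ V (renameDigraph D)
      bwd (inj₁ (i , x∈D)) = ∈-rename⁺ (Ds⊆V (original i) (∈-rename⁻ x∈D))
      bwd (inj₂ x∈xs) = ∈-rename⁺ (xs⊆V (∈-rename⁻ x∈xs))

    arcs′ : ∀ a → a ∈ A (renameDigraph D) ⇔′
              ((∃[ i ] (a ∈ A (Ds′ i) × ¬ InDigon (eu T′ i) (ev T′ i) a)) ⊎ a ∈ cyclicArcs (map s xs))
    arcs′ a = fwd , bwd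
      where
      fwd : a ∈ A (renameDigraph D) →
            (∃[ i ] (a ∈ A (Ds′ i) × ¬ InDigon (eu T′ i) (ev T′ i) a)) ⊎ a ∈ cyclicArcs (map s xs)
      fwd a∈D with proj₁ (arcs (renameArc a)) (∈-renameArc⁻ a∈D)
      ... | inj₁ (j , ra∈Dⱼ , ¬d) = inj₁ (renamed j , ∈-renameArc⁺ (subst (λ j′ → renameArc a ∈ A (Ds j′)) (sym j≡) ra∈Dⱼ) ,
                                          ¬d ∘ subst (λ j′ → InDigon (eu T j′) (ev T j′) (renameArc a)) j≡ ∘ InDigon⁻ (renamed j))
        where
        j≡ : original (renamed j) ≡ j
        j≡ = unmapIndex-mapIndex renameArc (TE T) j
      ... | inj₂ ra∈C = inj₂ (subst (a ∈_) (sym (cyclicArcs-rename xs)) (∈-renameArc⁺ ra∈C))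
      bwd : (∃[ i ] (a ∈ A (Ds′ i) × ¬ InDigon (eu T′ i) (ev T′ i) a)) ⊎ a ∈ cyclicArcs (map s xs) →
            a ∈ A (renameDigraph D)
      bwd (inj₁ (i , a∈D , ¬d)) =
        ∈-renameArc⁺ (proj₂ (arcs (renameArc a)) (inj₁ (original i , ∈-renameArc⁻ a∈D , ¬d ∘ InDigon⁺ i)))
      bwd (inj₂ a∈C) =
        ∈-renameArc⁺ (proj₂ (arcs (renameArc a)) (inj₂ (∈-renameArc⁻ (subst (a ∈_) (cyclicArcs-rename xs) a∈C))))

    isTreeJoin′ : IsTreeJoin T′ (map s xs) Ds′ (renameDigraph D)
    isTreeJoin′ = subst (1 ≤_) (sym (length-map renameArc (TE T))) nonempty
                , partialEulerian′ , tree-vertices′ , digons′ , disjoint-interiors′ , vertices′ , arcs′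

  EHT-rename : ∀ {k D} → EHT k D → EHT k (renameDigraph D)
  EHT-rename (wheel k≡3 ℓ 1≤ℓ D D-sym) = wheel k≡3 ℓ 1≤ℓ (renameDigraph D) (IsSymOf-rename {D = D} D-sym)
  EHT-rename (complete 4≤k D D-sym) = complete 4≤k (renameDigraph D) (IsSymOf-rename {D = D} D-sym)
  EHT-rename (treeJoin T xs Ds D Ds-EHT tj) =
    treeJoin (renameTree T) (map s xs) (RenamedTreeJoin.Ds′ T xs Ds D tj) (renameDigraph D)
      (λ i → EHT-rename (Ds-EHT (unmapIndex renameArc (TE T) i))) (RenamedTreeJoin.isTreeJoin′ T xs Ds D tj)

swap₁₂ : ∀ {P Q R : Set} → P ⊎ Q ⊎ R → Q ⊎ P ⊎ R
swap₁₂ (inj₁ p) = inj₂ (inj₁ p)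
swap₁₂ (inj₂ (inj₁ q)) = inj₁ q
swap₁₂ (inj₂ (inj₂ r)) = inj₂ (inj₂ r)

⇔-swap : ∀ {X P Q : Set} → X ⇔′ (P ⊎ Q) → X ⇔′ (Q ⊎ P)
⇔-swap (to , from) = Sum.swap ∘ to , from ∘ Sum.swap

⇔-swap₁₂ : ∀ {X P Q R : Set} → X ⇔′ (P ⊎ Q ⊎ R) → X ⇔′ (Q ⊎ P ⊎ R)
⇔-swap₁₂ (to , from) = swap₁₂ ∘ to , from ∘ swap₁₂

module _ {k u v w : ℕ} where

  -- Induction on the derivation of D₂: an arc vw inside a component is handled in that component.
  hajosJoin-EHT-rooted : ∀ {D₁ D₂ D R₁} → RootedTreeJoin k D₁ v (R₁ ++ [ u ]) → EHT k D₂ →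
                         HajosJoinAt D₁ D₂ u v w D → EHT k D
  hajosJoin-EHT-rooted {D₁} {D₂} {D} {R₁} rooted₁ D₂-EHT join = go D₂-EHT
    where
    open HajosJoinAt join
    v≢w : v ≢ w
    v≢w refl = loopless D₂ vw∈D₂
    glue : ∀ {R₂} → RootedTreeJoin k D₂ v (w ∷ R₂) → EHT k D
    glue rooted₂ = GlueRooted.glued-EHT rooted₁ rooted₂ join
    glue-symmetric : EHT k D₂ → Symmetric D₂ → EHT k D
    glue-symmetric D₂-EHT D₂-sym with Symmetric⇒TreeJoinOf D₂-EHT D₂-sym vw∈D₂
    ... | t , vw∈C = glue (proj₂ (rootAtSource t v≢w vw∈C))
    go : EHT k D₂ → EHT k D
    go p@(wheel _ ℓ _ _ sym-of) = glue-symmetric p (IsSymOf⇒Symmetric {D = D₂} (WheelAdj-sym ℓ) sym-of)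
    go p@(complete _ _ sym-of) = glue-symmetric p (IsSymOf⇒Symmetric {D = D₂} KAdj-sym sym-of)
    go (treeJoin T xs Ds _ Ds-EHT tj) with proj₁ (TreeJoin.arcs T xs Ds D₂ tj (v , w)) vw∈D₂
    ... | inj₂ vw∈C = glue (proj₂ (rootAtSource t v≢w vw∈C))
      where
      t : TreeJoinOf k D₂
      t = record { tree = T ; cycle = xs ; components = Ds ; components-EHT = Ds-EHT ; isTreeJoin = tj }
    ... | inj₁ (j , vw∈Dⱼ , vw-off-digon) =
      ReplaceComponent.replaced-EHT {k} {D₂} T xs Ds Ds-EHT tj j vw∈Dⱼ vw-off-digon D₁ Y v
        (λ x∈D₁ x∈D₂ → shared x∈D₁ x∈D₂) (proj₁ (A-in-V (Ds j) vw∈Dⱼ)) Y-off-digon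
        (proj₁ joined) (hajosJoin-EHT-rooted rooted₁ (Ds-EHT j) (proj₂ joined))
        (λ x → ⇔-swap (HajosJoinAt.vertices (proj₂ joined) x)) (λ a → ⇔-swap₁₂ (HajosJoinAt.arcs (proj₂ joined) a))
        D (λ x → ⇔-swap (vertices x)) (λ a → ⇔-swap₁₂ (arcs a))
      where
      open TreeJoin T xs Ds D₂ tj using (Ds⊆V; InDigon⇒∈V)
      joined : Σ Digraph (HajosJoinAt D₁ (Ds j) u v w)
      joined = hajosJoinAt D₁ (Ds j) u v w (λ x∈D₁ x∈Dⱼ → shared x∈D₁ (Ds⊆V j x∈Dⱼ)) uv∈D₁ vw∈Dⱼ
      Y : Arc → Set
      Y a = (a ∈ A D₁ × a ≢ (u , v)) ⊎ a ≡ (u , w)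
      -- Both ends of the digon lie in D₂, which meets D₁ only in v.
      Y-off-digon : ∀ {a} → Y a → ¬ InDigon (eu T j) (ev T j) a
      Y-off-digon (inj₁ (ab∈D₁ , _)) d with InDigon⇒∈V j d
      ... | a∈D₂ , b∈D₂ with shared (proj₁ (A-in-V D₁ ab∈D₁)) a∈D₂ | shared (proj₂ (A-in-V D₁ ab∈D₁)) b∈D₂
      ...   | refl | refl = loopless D₁ ab∈D₁
      Y-off-digon (inj₂ refl) d with shared (proj₁ (A-in-V D₁ uv∈D₁)) (proj₁ (InDigon⇒∈V j d))
      ... | refl = loopless D₁ uv∈D₁

  hajosJoin-EHT : ∀ {D₁ D₂ D} → EHT k D₁ → EHT k D₂ → HajosJoinAt D₁ D₂ u v w D → EHT k D
  hajosJoin-EHT {D₁} {D₂} {D} D₁-EHT D₂-EHT join = go D₁-EHT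
    where
    open HajosJoinAt join
    u≢v : u ≢ v
    u≢v refl = loopless D₁ uv∈D₁
    glue : ∀ {R₁} → RootedTreeJoin k D₁ v (R₁ ++ [ u ]) → EHT k D
    glue rooted₁ = hajosJoin-EHT-rooted rooted₁ D₂-EHT join
    glue-symmetric : EHT k D₁ → Symmetric D₁ → EHT k D
    glue-symmetric D₁-EHT D₁-sym with Symmetric⇒TreeJoinOf D₁-EHT D₁-sym uv∈D₁
    ... | t , uv∈C = glue (proj₂ (rootAtTarget t u≢v uv∈C))
    go : EHT k D₁ → EHT k D
    go p@(wheel _ ℓ _ _ sym-of) = glue-symmetric p (IsSymOf⇒Symmetric {D = D₁} (WheelAdj-sym ℓ) sym-of)
    go p@(complete _ _ sym-of) = glue-symmetric p (IsSymOf⇒Symmetric {D = D₁} KAdj-sym sym-of)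
    go (treeJoin T xs Ds _ Ds-EHT tj) with proj₁ (TreeJoin.arcs T xs Ds D₁ tj (u , v)) uv∈D₁
    ... | inj₂ uv∈C = glue (proj₂ (rootAtTarget t u≢v uv∈C))
      where
      t : TreeJoinOf k D₁
      t = record { tree = T ; cycle = xs ; components = Ds ; components-EHT = Ds-EHT ; isTreeJoin = tj }
    ... | inj₁ (i , uv∈Dᵢ , uv-off-digon) =
      ReplaceComponent.replaced-EHT {k} {D₁} T xs Ds Ds-EHT tj i uv∈Dᵢ uv-off-digon D₂ Y v
        (λ x∈D₂ x∈D₁ → shared x∈D₁ x∈D₂) (proj₂ (A-in-V (Ds i) uv∈Dᵢ)) Y-off-digon
        (proj₁ joined) (hajosJoin-EHT (Ds-EHT i) D₂-EHT (proj₂ joined))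
        (HajosJoinAt.vertices (proj₂ joined)) (HajosJoinAt.arcs (proj₂ joined)) D vertices arcs
      where
      open TreeJoin T xs Ds D₁ tj using (Ds⊆V; InDigon⇒∈V)
      joined : Σ Digraph (HajosJoinAt (Ds i) D₂ u v w)
      joined = hajosJoinAt (Ds i) D₂ u v w (λ x∈Dᵢ x∈D₂ → shared (Ds⊆V i x∈Dᵢ) x∈D₂) uv∈Dᵢ vw∈D₂
      Y : Arc → Set
      Y a = (a ∈ A D₂ × a ≢ (v , w)) ⊎ a ≡ (u , w)
      Y-off-digon : ∀ {a} → Y a → ¬ InDigon (eu T i) (ev T i) a
      Y-off-digon (inj₁ (ab∈D₂ , _)) d with InDigon⇒∈V i d
      ... | a∈D₁ , b∈D₁ with shared a∈D₁ (proj₁ (A-in-V D₂ ab∈D₂)) | shared b∈D₁ (proj₂ (A-in-V D₂ ab∈D₂))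
      ...   | refl | refl = loopless D₂ ab∈D₂
      Y-off-digon (inj₂ refl) d with shared (proj₂ (InDigon⇒∈V i d)) (proj₂ (A-in-V D₂ vw∈D₂))
      ... | refl = loopless D₂ vw∈D₂

-- Identifying v₂ with v₁ by the transposition of v₁ and v₂

transpose : ℕ → ℕ → ℕ → ℕ
transpose a b x with x ≟ a | x ≟ b
... | yes _ | _ = b
... | no _ | yes _ = a
... | no _ | no _ = x

transpose-a : ∀ a b → transpose a b a ≡ b
transpose-a a b with a ≟ a
... | yes _ = refl
... | no a≢a = ⊥-elim (a≢a refl)

transpose-b : ∀ a b → transpose a b b ≡ a
transpose-b a b with b ≟ a | b ≟ b
... | yes b≡a | _ = b≡a
... | no _ | yes _ = refl
... | no _ | no b≢b = ⊥-elim (b≢b refl)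

transpose-other : ∀ {a b x} → x ≢ a → x ≢ b → transpose a b x ≡ x
transpose-other {a} {b} {x} x≢a x≢b with x ≟ a | x ≟ b
... | yes x≡a | _ = ⊥-elim (x≢a x≡a)
... | no _ | yes x≡b = ⊥-elim (x≢b x≡b)
... | no _ | no _ = refl

transpose-involutive : ∀ a b x → transpose a b (transpose a b x) ≡ x
transpose-involutive a b x with x ≟ a | x ≟ b
... | yes refl | _ = transpose-b x b
... | no _ | yes refl = transpose-a a x
... | no x≢a | no x≢b = transpose-other x≢a x≢b

module RenamedHajosJoin (D₁ D₂ : Digraph) (disjoint : ∀ x → x ∈ V D₁ → x ∈ V D₂ → ⊥)
  (u v₁ v₂ w : ℕ) (uv₁∈D₁ : (u , v₁) ∈ A D₁) (v₂w∈D₂ : (v₂ , w) ∈ A D₂)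
  (D : Digraph) (join : IsHajosJoin D₁ D₂ u v₁ v₂ w D) where

  open Renaming (transpose v₁ v₂) (transpose-involutive v₁ v₂)

  D₂′ : Digraph
  D₂′ = renameDigraph D₂

  v₁∉D₂ : v₁ ∉ V D₂
  v₁∉D₂ = disjoint v₁ (proj₂ (A-in-V D₁ uv₁∈D₁))

  v₂w↦v₁w : renameArc (v₂ , w) ≡ (v₁ , w)
  v₂w↦v₁w = cong₂ _,_ (transpose-b v₁ v₂) (transpose-other w≢v₁ w≢v₂)
    where
    w≢v₁ : w ≢ v₁
    w≢v₁ refl = v₁∉D₂ (proj₂ (A-in-V D₂ v₂w∈D₂))
    w≢v₂ : w ≢ v₂
    w≢v₂ refl = loopless D₂ v₂w∈D₂

  v₁w↦v₂w : renameArc (v₁ , w) ≡ (v₂ , w)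
  v₁w↦v₂w = trans (cong renameArc (sym v₂w↦v₁w)) (renameArc-involutive (v₂ , w))

  -- On V(D₂), which avoids v₁, the renaming of IsHajosJoin agrees with the transposition.
  rename≗transpose : ∀ {y} → y ∈ V D₂ → rename v₂ v₁ y ≡ transpose v₁ v₂ y
  rename≗transpose {y} y∈D₂ = by-cases (y ≟ v₂)
    where
    by-cases : Dec (y ≡ v₂) → rename v₂ v₁ y ≡ transpose v₁ v₂ y
    by-cases (yes refl) = trans (cong (if_then v₁ else y) (dec-true (y ≟ y) refl)) (sym (transpose-b v₁ y))
    by-cases (no y≢v₂) = trans (cong (if_then v₁ else y) (dec-false (y ≟ v₂) y≢v₂))
                               (sym (transpose-other (λ { refl → v₁∉D₂ y∈D₂ }) y≢v₂))

  rename≗renameArc : ∀ {b} → b ∈ A D₂ → (rename v₂ v₁ (proj₁ b) , rename v₂ v₁ (proj₂ b)) ≡ renameArc b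
  rename≗renameArc b∈D₂ = cong₂ _,_ (rename≗transpose (proj₁ (A-in-V D₂ b∈D₂))) (rename≗transpose (proj₂ (A-in-V D₂ b∈D₂)))

  ∈-D₂′⁻ : ∀ {x} → x ∈ V D₂′ → x ≡ v₁ ⊎ (x ∈ V D₂ × x ≢ v₂)
  ∈-D₂′⁻ {x} x∈D₂′ with x ≟ v₁ | x ≟ v₂
  ... | yes x≡v₁ | _ = inj₁ x≡v₁
  ... | no _ | yes refl = ⊥-elim (v₁∉D₂ (subst (_∈ V D₂) (transpose-b v₁ x) (∈-rename⁻ x∈D₂′)))
  ... | no x≢v₁ | no x≢v₂ = inj₂ (subst (_∈ V D₂) (transpose-other x≢v₁ x≢v₂) (∈-rename⁻ x∈D₂′) , x≢v₂)

  ∈-D₂′⁺ : ∀ {x} → x ∈ V D₂ × x ≢ v₂ → x ∈ V D₂′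
  ∈-D₂′⁺ (x∈D₂ , x≢v₂) = ∈-rename⁺ (subst (_∈ V D₂) (sym (transpose-other (λ { refl → v₁∉D₂ x∈D₂ }) x≢v₂)) x∈D₂)

  vertices : ∀ x → x ∈ V D ⇔′ (x ∈ V D₁ ⊎ x ∈ V D₂′)
  vertices x = Sum.map₂ ∈-D₂′⁺ ∘ proj₁ (proj₁ join x) , proj₂ (proj₁ join x) ∘ Sum.[ inj₁ , unrenamed ]′
    where
    unrenamed : x ∈ V D₂′ → x ∈ V D₁ ⊎ (x ∈ V D₂ × x ≢ v₂)
    unrenamed x∈D₂′ with ∈-D₂′⁻ x∈D₂′
    ... | inj₁ refl = inj₁ (proj₂ (A-in-V D₁ uv₁∈D₁))
    ... | inj₂ x∈D₂ = inj₂ x∈D₂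

  arcs : ∀ a → a ∈ A D ⇔′ ((a ∈ A D₁ × a ≢ (u , v₁)) ⊎ (a ∈ A D₂′ × a ≢ (v₁ , w)) ⊎ a ≡ (u , w))
  arcs a = Sum.map₂ (Sum.map₁ fromRenamed) ∘ proj₁ (proj₂ join a) , proj₂ (proj₂ join a) ∘ Sum.map₂ (Sum.map₁ toRenamed)
    where
    fromRenamed : ∃[ b ] (b ∈ A D₂ × b ≢ (v₂ , w) × a ≡ (rename v₂ v₁ (proj₁ b) , rename v₂ v₁ (proj₂ b))) →
                  a ∈ A D₂′ × a ≢ (v₁ , w)
    fromRenamed (b , b∈D₂ , b≢v₂w , refl) =
        subst (_∈ A D₂′) (sym (rename≗renameArc b∈D₂)) (∈-map⁺ renameArc b∈D₂)
      , λ a≡v₁w → b≢v₂w (renameArc-injective (trans (sym (rename≗renameArc b∈D₂)) (trans a≡v₁w (sym v₂w↦v₁w))))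
    toRenamed : a ∈ A D₂′ × a ≢ (v₁ , w) →
                ∃[ b ] (b ∈ A D₂ × b ≢ (v₂ , w) × a ≡ (rename v₂ v₁ (proj₁ b) , rename v₂ v₁ (proj₂ b)))
    toRenamed (a∈D₂′ , a≢v₁w) =
        renameArc a , ∈-renameArc⁻ a∈D₂′
      , (λ b≡v₂w → a≢v₁w (trans (sym (renameArc-involutive a)) (trans (cong renameArc b≡v₂w) v₂w↦v₁w)))
      , sym (trans (rename≗renameArc (∈-renameArc⁻ a∈D₂′)) (renameArc-involutive a))

  hajosJoinAt′ : HajosJoinAt D₁ D₂′ u v₁ w D
  hajosJoinAt′ = record
    { shared = λ x∈D₁ x∈D₂′ → Sum.[ (λ x≡v₁ → x≡v₁) , (λ (x∈D₂ , _) → ⊥-elim (disjoint _ x∈D₁ x∈D₂)) ]′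
                                    (∈-D₂′⁻ x∈D₂′)
    ; uv∈D₁ = uv₁∈D₁
    ; vw∈D₂ = ∈-renameArc⁺ (subst (_∈ A D₂) (sym v₁w↦v₂w) v₂w∈D₂)
    ; vertices = vertices
    ; arcs = arcs
    }

lemma6p4 : ∀ (k : ℕ) → 3 ≤ k → ∀ (D₁ D₂ : Digraph) → EHT k D₁ → EHT k D₂ →
           (∀ x → x ∈ V D₁ → x ∈ V D₂ → ⊥) →
           ∀ (u v₁ v₂ w : ℕ) → (u , v₁) ∈ A D₁ → (v₂ , w) ∈ A D₂ →
           ∀ (D : Digraph) → IsHajosJoin D₁ D₂ u v₁ v₂ w D → EHT k D
lemma6p4 k _ D₁ D₂ D₁-EHT D₂-EHT disjoint u v₁ v₂ w uv₁∈D₁ v₂w∈D₂ D join =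
  hajosJoin-EHT D₁-EHT (EHT-rename D₂-EHT) hajosJoinAt′
  where
  open RenamedHajosJoin D₁ D₂ disjoint u v₁ v₂ w uv₁∈D₁ v₂w∈D₂ D join using (hajosJoinAt′)
  open Renaming (transpose v₁ v₂) (transpose-involutive v₁ v₂) using (EHT-rename)
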